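{- For any $f,g\in\mathbb{F}_q[t]$, if $g\le f$ then $g!\mid f!$.
   Context: Let $\mathbb{F}_q$ be a finite field with $q$ elements ($q$ a prime power). Fix an enumeration $\mathbb{F}_q=\{a_0,a_1,\dots,a_{q-1}\}$ with $a_0=0$, $a_1=1$. Every nonzero $f\in\mathbb{F}_q[t]$ of degree $m$ is uniquely written $f=a_{i_0}+a_{i_1}t+\dots+a_{i_m}t^m$ with $0\le i_j\le q-1$, $a_{i_m}\neq 0$. Put $\delta(f)=i_0+i_1q+\dots+i_mq^m$ and $\delta(0)=0$. Order $\mathbb{F}_q[t]$ by: $f>g$ iff $\delta(f)>\delta(g)$, and $g\le f$ iff $g<f$ or $g=f$. For nonzero $f$, $f!=\prod_{g<f}(f-g)$ (product over all $g\in\mathbb{F}_q[t]$ with $g<f$), and $0!=1$. -}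

module Defs where

open import Level using (Level; _⊔_) renaming (suc to lsuc)
open import Algebra.Bundles using (CommutativeRing)
open import Data.Nat using (ℕ; zero; suc; _<_) renaming (_+_ to _+ℕ_; _*_ to _*ℕ_)
open import Data.Nat.DivMod using (_mod_; _/_)
open import Data.Fin using (Fin; toℕ) renaming (zero to fzero; suc to fsuc)
open import Data.List using (List; []; _∷_; map)
open import Data.Product using (Σ; ∃)
open import Data.Sum using (_⊎_)
open import Relation.Nullary using (¬_)
open import Relation.Binary.PropositionalEquality using (_≡_)

-- A finite field F_q (q = 2 + k elements) together with a fixed enumeration
-- a_0 , ... , a_{q-1} of its elements, with a_0 = 0 and a_1 = 1.
-- The enumeration is a bijection  Fin q ≅ Carrier  (up to the setoid equality).
record FiniteField (c ℓ : Level) : Set (lsuc (c ⊔ ℓ)) where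
  field
    commRing : CommutativeRing c ℓ
  open CommutativeRing commRing public
  field
    0≉1        : ¬ (0# ≈ 1#)
    inverse    : ∀ x → ¬ (x ≈ 0#) → ∃ λ y → x * y ≈ 1#
    k          : ℕ
    enum       : Fin (suc (suc k)) → Carrier
    index      : Carrier → Fin (suc (suc k))
    enum-index : ∀ x → enum (index x) ≈ x
    index-enum : ∀ i → index (enum i) ≡ i
    index-cong : ∀ {x y} → x ≈ y → index x ≡ index y
    enum-0     : enum fzero ≈ 0#
    enum-1     : enum (fsuc fzero) ≈ 1#

  q : ℕ
  q = suc (suc k)

module Poly {c ℓ} (F : FiniteField c ℓ) where
  open FiniteField F using (Carrier; _≈_; 0#; 1#; enum; index; q) renaming (_+_ to _+F_; _*_ to _*F_; -_ to -F_)

  -- polynomials in F_q[t] as coefficient lists [c_0, c_1, ..., c_m] (lowest first)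
  Pol : Set c
  Pol = List Carrier

  coeff : Pol → ℕ → Carrier
  coeff []      _       = 0#
  coeff (a ∷ p) zero    = a
  coeff (a ∷ p) (suc n) = coeff p n

  infix 4 _≈ₚ_
  _≈ₚ_ : Pol → Pol → Set ℓ
  p ≈ₚ r = ∀ n → coeff p n ≈ coeff r n

  infixl 6 _+ₚ_ _-ₚ_
  infixl 7 _*ₚ_
  _+ₚ_ : Pol → Pol → Pol
  []      +ₚ r       = r
  (a ∷ p) +ₚ []      = a ∷ p
  (a ∷ p) +ₚ (b ∷ r) = (a +F b) ∷ (p +ₚ r)

  -ₚ_ : Pol → Pol
  -ₚ p = map -F_ p

  _-ₚ_ : Pol → Pol → Pol
  p -ₚ r = p +ₚ (-ₚ r)

  _*ₚ_ : Pol → Pol → Pol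
  []      *ₚ r = []
  (a ∷ p) *ₚ r = map (a *F_) r +ₚ (0# ∷ (p *ₚ r))

  1ₚ : Pol
  1ₚ = 1# ∷ []

  infix 4 _∣ₚ_
  _∣ₚ_ : Pol → Pol → Set (c ⊔ ℓ)
  g ∣ₚ f = Σ Pol λ h → g *ₚ h ≈ₚ f

  -- δ(f) = i_0 + i_1 q + ... + i_m q^m  where c_j = a_{i_j}
  -- (trailing zero coefficients contribute 0 since index 0 = 0)
  δ : Pol → ℕ
  δ []      = 0
  δ (a ∷ p) = toℕ (index a) +ℕ q *ℕ δ p

  infix 4 _<ₚ_ _≤ₚ_
  _<ₚ_ : Pol → Pol → Set
  g <ₚ f = δ g < δ f

  _≤ₚ_ : Pol → Pol → Set ℓ
  g ≤ₚ f = (g <ₚ f) ⊎ (g ≈ₚ f)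

  -- the unique polynomial with δ = n: base-q digits of n mapped through the
  -- enumeration (first argument is fuel; n digits always suffice)
  decodeAux : ℕ → ℕ → Pol
  decodeAux zero     n = []
  decodeAux (suc fu) n = enum (n mod q) ∷ decodeAux fu (n / q)

  decode : ℕ → Pol
  decode n = decodeAux n n

  prodBelow : Pol → ℕ → Pol
  prodBelow f zero    = 1ₚ
  prodBelow f (suc n) = prodBelow f n *ₚ (f -ₚ decode n)

  -- f! = ∏_{g < f} (f - g); the g with g < f are exactly decode 0, ..., decode (δ f - 1).
  -- For f = 0 (δ f = 0) this is the empty product 1.
  fact : Pol → Pol
  fact f = prodBelow f (δ f)

-- Write n = δ f in base q. The polynomials g < f come in blocks of q ^ m consecutive ones
-- sharing their coefficients above degree m, so each block contributes a value of
-- P_m(x) = ∏_{deg h < m} (x - h). Homogenising X^q - X = ∏_a (X - a) and (X + 1)^q = X^q + 1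
-- shows that P_m is 𝔽_q-linear with P_{m+1} = P_m^q - D_m^{q-1} P_m, where D_m = P_m(t^m).
-- Hence f! is a unit times ∏_m D_m^{d_m}, d_m the digits of δ f, and Carlitz's recursion
-- D_{m+1} = D_m^q [m+1] gives (decode n)! ∣ D_m for n < q ^ m. Comparing leading digits then
-- shows that n ↦ (decode n)! is monotone for divisibility.

{-# OPTIONS --safe #-}
module Submission where

open import Defs
open import Level using (Level; _⊔_)
open import Algebra.Bundles using (CommutativeRing; CommutativeSemiring; RawRing)
open import Algebra.Morphism.Structures using (IsRingHomomorphism)
open import Algebra.Solver.Ring.AlmostCommutativeRing using (fromCommutativeRing; _-Raw-AlmostCommutative⟶_)
open import Data.Empty using (⊥-elim)
open import Data.Fin using (Fin; toℕ) renaming (zero to fzero; suc to fsuc)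
open import Data.Fin.Permutation using (Permutation′; permutation)
open import Data.List using (List; []; _∷_; map; length; take)
open import Data.Maybe using (Maybe; just; nothing)
open import Data.Nat using (ℕ; zero; suc; _≤_; _<_; z≤n; s≤s; _∸_; _%_; _/_)
open import Data.Nat.DivMod using (_mod_; m<n⇒m%n≡m; [m+kn]%n≡m%n; +-distrib-/-∣ʳ; m*n/n≡m; m<n⇒m/n≡0; m<n*o⇒m/o<n; m≡m%n+[m/n]*n; m%n<n)
open import Data.Nat.Divisibility using (divides)
open import Data.Product using (Σ; ∃₂; _×_; _,_; proj₁; proj₂)
open import Data.Sum using (_⊎_; inj₁; inj₂)
open import Function using (case_of_)
open import Relation.Binary.Bundles using (Setoid)
open import Relation.Binary.Definitions using (tri<; tri≈; tri>)
open import Relation.Binary.PropositionalEquality using (_≡_; _≢_)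
open import Relation.Nullary using (¬_; yes; no)
import Data.Fin as Fin
import Data.Fin.Properties as Fin
import Data.List.Properties as List
import Data.Nat.Properties as ℕ
import Relation.Binary.PropositionalEquality as ≡
import Algebra.Properties.CommutativeMonoid.Sum
import Algebra.Properties.CommutativeSemigroup
import Algebra.Properties.CommutativeSemigroup.Divisibility
import Algebra.Properties.CommutativeSemiring.Exp
import Algebra.Properties.Monoid.Divisibility
import Algebra.Properties.Ring
import Algebra.Properties.Semiring.Exp
import Algebra.Properties.Semiring.Mult
import Algebra.Solver.Ring
import Relation.Binary.Reasoning.Setoid

module CommutativeRingSolver {c ℓ : Level} (R : CommutativeRing c ℓ) where

  open import Data.Nat using () renaming (_+_ to _+ℕ_; _*_ to _*ℕ_)

  open CommutativeRing R
  open Algebra.Properties.Semiring.Mult semiring using (×-homo-+; ×1-homo-*; ×-congˡ) renaming (_×_ to _·_)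
  open Algebra.Properties.Ring ring using (-‿involutive; -‿distribˡ-*; -‿distribʳ-*; -‿+-comm; -0#≈0#)
  open Algebra.Properties.CommutativeSemigroup +-commutativeSemigroup using (interchange)
  open Relation.Binary.Reasoning.Setoid setoid

  -- Integer coefficients, (m , n) standing for m - n: their equality is decidable, so the
  -- solver can cancel terms in any commutative ring.
  ℕ²-rawRing : RawRing _ _
  ℕ²-rawRing = record
    { Carrier = ℕ × ℕ
    ; _≈_ = _≡_
    ; _+_ = λ { (a , b) (c , d) → (a +ℕ c , b +ℕ d) }
    ; _*_ = λ { (a , b) (c , d) → (a *ℕ c +ℕ b *ℕ d , a *ℕ d +ℕ b *ℕ c) }
    ; -_ = λ { (a , b) → (b , a) }
    ; 0# = (0 , 0)
    ; 1# = (1 , 0)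
    }

  ⟦_⟧ℕ : ℕ → Carrier
  ⟦ n ⟧ℕ = n · 1#

  ⟦_⟧ℕ² : ℕ × ℕ → Carrier
  ⟦ a , b ⟧ℕ² = ⟦ a ⟧ℕ - ⟦ b ⟧ℕ

  -+-interchange : ∀ x y z w → (x - y) + (z - w) ≈ (x + z) - (y + w)
  -+-interchange x y z w = trans (interchange x (- y) z (- w)) (+-congˡ (-‿+-comm y w))

  -*-expand : ∀ x y z w → (x - y) * (z - w) ≈ (x * z + y * w) - (x * w + y * z)
  -*-expand x y z w = begin
    (x - y) * (z - w)                     ≈⟨ distribʳ _ _ _ ⟩
    x * (z - w) + - y * (z - w)           ≈⟨ +-cong (distribˡ _ _ _) (distribˡ _ _ _) ⟩
    (x * z + x * - w) + (- y * z + - y * - w)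
      ≈⟨ +-cong (+-congˡ (sym (-‿distribʳ-* x w))) (+-cong (sym (-‿distribˡ-* y z)) neg-neg) ⟩
    (x * z - x * w) + (- (y * z) + y * w) ≈⟨ +-congˡ (+-comm _ _) ⟩
    (x * z - x * w) + (y * w - y * z)     ≈⟨ -+-interchange _ _ _ _ ⟩
    (x * z + y * w) - (x * w + y * z)     ∎
    where
    neg-neg : - y * - w ≈ y * w
    neg-neg = trans (sym (-‿distribˡ-* y (- w))) (trans (-‿cong (sym (-‿distribʳ-* y w))) (-‿involutive _))

  ℕ²-homomorphism : ℕ²-rawRing -Raw-AlmostCommutative⟶ fromCommutativeRing R
  ℕ²-homomorphism = record
    { ⟦_⟧ = ⟦_⟧ℕ²
    ; +-homo = λ { (a , b) (c , d) →
        trans (+-cong (×-homo-+ 1# a c) (-‿cong (×-homo-+ 1# b d))) (sym (-+-interchange _ _ _ _)) }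
    ; *-homo = λ { (a , b) (c , d) →
        trans (+-cong (×-homo-+-* a c b d) (-‿cong (×-homo-+-* a d b c))) (sym (-*-expand _ _ _ _)) }
    ; -‿homo = λ { (a , b) → trans (+-comm _ _) (trans (+-congˡ (sym (-‿involutive _))) (-‿+-comm _ _)) }
    ; 0-homo = -‿inverseʳ _
    ; 1-homo = trans (+-cong (+-identityʳ 1#) -0#≈0#) (+-identityʳ _)
    }
    where
    ×-homo-+-* : ∀ a c b d → ⟦ a *ℕ c +ℕ b *ℕ d ⟧ℕ ≈ ⟦ a ⟧ℕ * ⟦ c ⟧ℕ + ⟦ b ⟧ℕ * ⟦ d ⟧ℕ
    ×-homo-+-* a c b d = trans (×-homo-+ 1# (a *ℕ c) (b *ℕ d)) (+-cong (×1-homo-* a c) (×1-homo-* b d))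

  ⟦⟧ℕ²-cong : ∀ x y → Maybe (⟦ x ⟧ℕ² ≈ ⟦ y ⟧ℕ²)
  ⟦⟧ℕ²-cong (a , b) (c , d) with a +ℕ d ℕ.≟ c +ℕ b
  ... | no _ = nothing
  ... | yes a+d≡c+b = just (begin
    ⟦ a ⟧ℕ - ⟦ b ⟧ℕ                          ≈⟨ sym (+-identityʳ _) ⟩
    (⟦ a ⟧ℕ - ⟦ b ⟧ℕ) + 0#                   ≈⟨ +-congˡ (sym (-‿inverseʳ _)) ⟩
    (⟦ a ⟧ℕ - ⟦ b ⟧ℕ) + (⟦ d ⟧ℕ - ⟦ d ⟧ℕ)    ≈⟨ -+-interchange _ _ _ _ ⟩
    (⟦ a ⟧ℕ + ⟦ d ⟧ℕ) - (⟦ b ⟧ℕ + ⟦ d ⟧ℕ)    ≈⟨ +-cong a+d≈c+b (-‿cong (+-comm _ _)) ⟩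
    (⟦ c ⟧ℕ + ⟦ b ⟧ℕ) - (⟦ d ⟧ℕ + ⟦ b ⟧ℕ)    ≈⟨ sym (-+-interchange _ _ _ _) ⟩
    (⟦ c ⟧ℕ - ⟦ d ⟧ℕ) + (⟦ b ⟧ℕ - ⟦ b ⟧ℕ)    ≈⟨ +-congˡ (-‿inverseʳ _) ⟩
    (⟦ c ⟧ℕ - ⟦ d ⟧ℕ) + 0#                   ≈⟨ +-identityʳ _ ⟩
    ⟦ c ⟧ℕ - ⟦ d ⟧ℕ                          ∎)
    where
    a+d≈c+b : ⟦ a ⟧ℕ + ⟦ d ⟧ℕ ≈ ⟦ c ⟧ℕ + ⟦ b ⟧ℕ
    a+d≈c+b = trans (sym (×-homo-+ 1# a d)) (trans (×-congˡ a+d≡c+b) (×-homo-+ 1# c b))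

  open Algebra.Solver.Ring ℕ²-rawRing (fromCommutativeRing R) ℕ²-homomorphism ⟦⟧ℕ²-cong public

module Products {c ℓ : Level} (R : CommutativeSemiring c ℓ) where

  open CommutativeSemiring R
  open Algebra.Properties.Semiring.Exp semiring using (_^_)

  ∏< : ℕ → (ℕ → Carrier) → Carrier
  ∏< zero    f = 1#
  ∏< (suc n) f = ∏< n f * f n

  ∏<-cong : ∀ {f g} n → (∀ j → f j ≈ g j) → ∏< n f ≈ ∏< n g
  ∏<-cong zero    f≈g = refl
  ∏<-cong (suc n) f≈g = *-cong (∏<-cong n f≈g) (f≈g n)

  ∏<-const : ∀ x n → ∏< n (λ _ → x) ≈ x ^ n
  ∏<-const x zero    = refl
  ∏<-const x (suc n) = trans (*-congʳ (∏<-const x n)) (*-comm _ _)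

  ∏<-zero : ∀ {f} n j → j < n → f j ≈ 0# → ∏< n f ≈ 0#
  ∏<-zero (suc n) j j<1+n fj≈0 with ℕ.m≤n⇒m<n∨m≡n (ℕ.≤-pred j<1+n)
  ... | inj₁ j<n     = trans (*-congʳ (∏<-zero n j j<n fj≈0)) (zeroˡ _)
  ... | inj₂ ≡.refl = trans (*-congˡ fj≈0) (zeroʳ _)


module FieldProperties {c ℓ : Level} (F : FiniteField c ℓ) where

  open FiniteField F hiding (zero)
  open Algebra.Properties.Semiring.Exp semiring using (_^_)
  private module ≈-Reasoning = Relation.Binary.Reasoning.Setoid setoid
  infix 4 _≉0
  _≉0 : Carrier → Set ℓ
  a ≉0 = ¬ (a ≈ 0#)

  x*y≈0∧y≉0⇒x≈0 : ∀ {x y} → x * y ≈ 0# → y ≉0 → x ≈ 0#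
  x*y≈0∧y≉0⇒x≈0 {x} {y} xy≈0 y≉0 = begin
    x             ≈⟨ sym (*-identityʳ x) ⟩
    x * 1#        ≈⟨ *-congˡ (sym (proj₂ (inverse y y≉0))) ⟩
    x * (y * y⁻¹) ≈⟨ sym (*-assoc _ _ _) ⟩
    (x * y) * y⁻¹ ≈⟨ *-congʳ xy≈0 ⟩
    0# * y⁻¹      ≈⟨ zeroˡ _ ⟩
    0#            ∎
    where
    open ≈-Reasoning
    y⁻¹ = proj₁ (inverse y y≉0)

  x≉0∧y≉0⇒x*y≉0 : ∀ {x y} → x ≉0 → y ≉0 → (x * y) ≉0
  x≉0∧y≉0⇒x*y≉0 x≉0 y≉0 xy≈0 = x≉0 (x*y≈0∧y≉0⇒x≈0 xy≈0 y≉0)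

  enum-injective : ∀ i j → enum i ≈ enum j → i ≡ j
  enum-injective i j e = ≡.trans (≡.sym (index-enum i)) (≡.trans (index-cong e) (index-enum j))

  x-y≈0⇒x≈y : ∀ {x y} → x - y ≈ 0# → x ≈ y
  x-y≈0⇒x≈y = Algebra.Properties.Ring.x∙y⁻¹≈ε⇒x≈y ring _ _

  ≈0-or-≉0 : ∀ x → x ≈ 0# ⊎ x ≉0
  ≈0-or-≉0 x with index x Fin.≟ fzero
  ... | yes i≡0 = inj₁ (trans (sym (enum-index x)) (trans (reflexive (≡.cong enum i≡0)) enum-0))
  ... | no  i≢0 = inj₂ λ x≈0 → i≢0 (≡.trans (index-cong (trans x≈0 (sym enum-0))) (index-enum fzero))

  digit : ℕ → Carrier
  digit j = enum (j mod q)

  toℕ-mod : ∀ n → toℕ (n mod q) ≡ n % q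
  toℕ-mod n = Fin.toℕ-fromℕ< _

  digit-index : ∀ x → digit (toℕ (index x)) ≈ x
  digit-index x = trans (reflexive (≡.cong enum toℕ-index-mod)) (enum-index x)
    where
    toℕ-index-mod : toℕ (index x) mod q ≡ index x
    toℕ-index-mod = Fin.toℕ-injective (≡.trans (toℕ-mod (toℕ (index x))) (m<n⇒m%n≡m (Fin.toℕ<n (index x))))

  digit-injective : ∀ {i j} → i < q → j < q → digit i ≈ digit j → i ≡ j
  digit-injective {i} {j} i<q j<q e = begin
    i                 ≡⟨ m<n⇒m%n≡m i<q ⟨
    i % q             ≡⟨ toℕ-mod i ⟨
    toℕ (i mod q) ≡⟨ ≡.cong toℕ (enum-injective _ _ e) ⟩
    toℕ (j mod q) ≡⟨ toℕ-mod j ⟩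
    j % q             ≡⟨ m<n⇒m%n≡m j<q ⟩
    j                 ∎
    where open ≡.≡-Reasoning

  unit : Fin (suc k) → Carrier
  unit i = enum (fsuc i)

  unit-≉0 : ∀ i → unit i ≉0
  unit-≉0 i e with enum-injective (fsuc i) fzero (trans e (sym enum-0))
  ... | ()

  unit-injective : ∀ i j → unit i ≈ unit j → i ≡ j
  unit-injective i j e = Fin.suc-injective (enum-injective (fsuc i) (fsuc j) e)

  unit-surjective : ∀ y → y ≉0 → Σ (Fin (suc k)) λ i → unit i ≈ y
  unit-surjective y y≉0 with index y in eq
  ... | fzero  = ⊥-elim (y≉0 (trans (sym (enum-index y)) (trans (reflexive (≡.cong enum eq)) enum-0)))
  ... | fsuc i = i , trans (reflexive (≡.cong enum (≡.sym eq))) (enum-index y)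

  scale : ∀ {y} → y ≉0 → Fin (suc k) → Fin (suc k)
  scale y≉0 i = proj₁ (unit-surjective _ (x≉0∧y≉0⇒x*y≉0 y≉0 (unit-≉0 i)))

  unit-scale : ∀ {y} (y≉0 : y ≉0) i → unit (scale y≉0 i) ≈ y * unit i
  unit-scale y≉0 i = proj₂ (unit-surjective _ (x≉0∧y≉0⇒x*y≉0 y≉0 (unit-≉0 i)))

  module _ {x : Carrier} (x≉0 : x ≉0) where

    private
      x⁻¹ : Carrier
      x⁻¹ = proj₁ (inverse x x≉0)

      x⁻¹≉0 : x⁻¹ ≉0
      x⁻¹≉0 e = 0≉1 (trans (sym (trans (*-congˡ e) (zeroʳ x))) (proj₂ (inverse x x≉0)))

      cancel : ∀ {y z} w → y * z ≈ 1# → y * (z * w) ≈ w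
      cancel w yz≈1 = trans (sym (*-assoc _ _ _)) (trans (*-congʳ yz≈1) (*-identityˡ w))

      multiplication : Permutation′ (suc k)
      multiplication = permutation (scale x≉0) (scale x⁻¹≉0)
        (λ i → unit-injective _ i (trans (unit-scale x≉0 _) (trans (*-congˡ (unit-scale x⁻¹≉0 i))
                                      (cancel (unit i) (proj₂ (inverse x x≉0))))))
        (λ i → unit-injective _ i (trans (unit-scale x⁻¹≉0 _) (trans (*-congˡ (unit-scale x≉0 i))
                                      (cancel (unit i) (trans (*-comm _ _) (proj₂ (inverse x x≉0)))))))

    -- Multiplication by x permutes the units, so their product is multiplied by x ^ (q - 1).
    fermat-≉0 : x ^ suc k ≈ 1#
    fermat-≉0 = sym (x-y≈0⇒x≈y (x*y≈0∧y≉0⇒x≈0 (begin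
      (1# - x ^ suc k) * ∏ unit           ≈⟨ [y-z]x≈yx-zx _ _ _ ⟩
      1# * ∏ unit - x ^ suc k * ∏ unit    ≈⟨ +-cong (*-identityˡ _) (-‿cong (sym ∏unit≈x^[q-1]∏unit)) ⟩
      ∏ unit - ∏ unit                     ≈⟨ -‿inverseʳ _ ⟩
      0#                                  ∎) (∏-≉0 unit unit-≉0)))
      where
      open ≈-Reasoning
      open Algebra.Properties.CommutativeMonoid.Sum *-commutativeMonoid
        using (sum-permute; sum-cong-≋; ∑-distrib-+; sum-replicate) renaming (sum to ∏)
      open Algebra.Properties.Ring ring using ([y-z]x≈yx-zx)
      ∏-≉0 : ∀ {n} (f : Fin n → Carrier) → (∀ i → f i ≉0) → ∏ f ≉0
      ∏-≉0 {zero}  f f≉0 ∏≈0 = 0≉1 (sym ∏≈0)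
      ∏-≉0 {suc n} f f≉0 = x≉0∧y≉0⇒x*y≉0 (f≉0 fzero) (∏-≉0 (λ i → f (fsuc i)) (λ i → f≉0 (fsuc i)))
      ∏unit≈x^[q-1]∏unit : ∏ unit ≈ x ^ suc k * ∏ unit
      ∏unit≈x^[q-1]∏unit = begin
        ∏ unit                           ≈⟨ sum-permute unit multiplication ⟩
        ∏ (λ i → unit (scale x≉0 i))     ≈⟨ sum-cong-≋ (unit-scale x≉0) ⟩
        ∏ (λ i → x * unit i)             ≈⟨ ∑-distrib-+ {suc k} (λ _ → x) unit ⟩
        ∏ {suc k} (λ _ → x) * ∏ unit     ≈⟨ *-congʳ (sum-replicate (suc k) {x}) ⟩
        x ^ suc k * ∏ unit               ∎

  fermat : ∀ x → x ^ q ≈ x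
  fermat x with ≈0-or-≉0 x
  ... | inj₁ x≈0 = trans (*-congʳ x≈0) (trans (zeroˡ _) (sym x≈0))
  ... | inj₂ x≉0 = trans (*-congˡ (fermat-≉0 x≉0)) (*-identityʳ x)

module PolynomialRing {c ℓ : Level} (F : FiniteField c ℓ) where

  open FiniteField F hiding (zero)
  open Poly F
  open Algebra.Properties.Ring ring using (-0#≈0#)
  private module ≈-Reasoning = Relation.Binary.Reasoning.Setoid setoid

  infixr 7 _·ₚ_
  _·ₚ_ : Carrier → Pol → Pol
  a ·ₚ p = map (a *_) p

  coeff-+ₚ : ∀ p r n → coeff (p +ₚ r) n ≈ coeff p n + coeff r n
  coeff-+ₚ []      r       n       = sym (+-identityˡ _)
  coeff-+ₚ (a ∷ p) []      n       = sym (+-identityʳ _)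
  coeff-+ₚ (a ∷ p) (b ∷ r) zero    = refl
  coeff-+ₚ (a ∷ p) (b ∷ r) (suc n) = coeff-+ₚ p r n

  coeff-·ₚ : ∀ a p n → coeff (a ·ₚ p) n ≈ a * coeff p n
  coeff-·ₚ a []      n       = sym (zeroʳ a)
  coeff-·ₚ a (b ∷ p) zero    = refl
  coeff-·ₚ a (b ∷ p) (suc n) = coeff-·ₚ a p n

  coeff--ₚ : ∀ p n → coeff (-ₚ p) n ≈ - coeff p n
  coeff--ₚ []      n       = sym -0#≈0#
  coeff--ₚ (a ∷ p) zero    = refl
  coeff--ₚ (a ∷ p) (suc n) = coeff--ₚ p n

  -- A record around _≈ₚ_, so that both polynomials can be inferred from an equality proof.
  infix 4 _≋_
  record _≋_ (p r : Pol) : Set ℓ where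
    constructor mk
    field coeff-≈ : p ≈ₚ r
  open _≋_ public

  ≋-refl : ∀ {p} → p ≋ p
  ≋-refl = mk λ n → refl

  ≋-sym : ∀ {p r} → p ≋ r → r ≋ p
  ≋-sym (mk e) = mk λ n → sym (e n)

  ≋-trans : ∀ {p r s} → p ≋ r → r ≋ s → p ≋ s
  ≋-trans (mk e) (mk f) = mk λ n → trans (e n) (f n)

  ≋-reflexive : ∀ {p r} → p ≡ r → p ≋ r
  ≋-reflexive ≡.refl = ≋-refl

  ≋-setoid : Setoid c ℓ
  ≋-setoid = record { Carrier = Pol ; _≈_ = _≋_
                    ; isEquivalence = record { refl = ≋-refl ; sym = ≋-sym ; trans = ≋-trans } }

  module ≋-Reasoning = Relation.Binary.Reasoning.Setoid ≋-setoid

  ∷-cong : ∀ {a b p r} → a ≈ b → p ≋ r → (a ∷ p) ≋ (b ∷ r)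
  ∷-cong a≈b (mk e) = mk λ { zero → a≈b ; (suc n) → e n }

  ∷-head : ∀ {a b p r} → (a ∷ p) ≋ (b ∷ r) → a ≈ b
  ∷-head (mk e) = e zero

  ∷-tail : ∀ {a b p r} → (a ∷ p) ≋ (b ∷ r) → p ≋ r
  ∷-tail (mk e) = mk λ n → e (suc n)

  ∷-≋[] : ∀ {a p} → a ≈ 0# → p ≋ [] → (a ∷ p) ≋ []
  ∷-≋[] a≈0 (mk e) = mk λ { zero → a≈0 ; (suc n) → e n }

  ∷-≋[]-head : ∀ {a p} → (a ∷ p) ≋ [] → a ≈ 0#
  ∷-≋[]-head (mk e) = e zero

  ∷-≋[]-tail : ∀ {a p} → (a ∷ p) ≋ [] → p ≋ []
  ∷-≋[]-tail (mk e) = mk λ n → e (suc n)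

  +ₚ-cong : ∀ {p p′ r r′} → p ≋ p′ → r ≋ r′ → p +ₚ r ≋ p′ +ₚ r′
  +ₚ-cong {p} {p′} {r} {r′} (mk e) (mk f) =
    mk λ n → trans (coeff-+ₚ p r n) (trans (+-cong (e n) (f n)) (sym (coeff-+ₚ p′ r′ n)))

  +ₚ-assoc : ∀ p r s → (p +ₚ r) +ₚ s ≋ p +ₚ (r +ₚ s)
  +ₚ-assoc p r s = mk λ n → begin
    coeff ((p +ₚ r) +ₚ s) n             ≈⟨ trans (coeff-+ₚ (p +ₚ r) s n) (+-congʳ (coeff-+ₚ p r n)) ⟩
    (coeff p n + coeff r n) + coeff s n ≈⟨ +-assoc _ _ _ ⟩
    coeff p n + (coeff r n + coeff s n) ≈⟨ sym (trans (coeff-+ₚ p (r +ₚ s) n) (+-congˡ (coeff-+ₚ r s n))) ⟩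
    coeff (p +ₚ (r +ₚ s)) n             ∎
    where open ≈-Reasoning

  +ₚ-comm : ∀ p r → p +ₚ r ≋ r +ₚ p
  +ₚ-comm p r = mk λ n → trans (coeff-+ₚ p r n) (trans (+-comm _ _) (sym (coeff-+ₚ r p n)))

  +ₚ-identityˡ : ∀ p → [] +ₚ p ≋ p
  +ₚ-identityˡ p = ≋-refl

  +ₚ-identityʳ : ∀ p → p +ₚ [] ≋ p
  +ₚ-identityʳ p = mk λ n → trans (coeff-+ₚ p [] n) (+-identityʳ _)

  -ₚ-cong : ∀ {p r} → p ≋ r → -ₚ p ≋ -ₚ r
  -ₚ-cong {p} {r} (mk e) = mk λ n → trans (coeff--ₚ p n) (trans (-‿cong (e n)) (sym (coeff--ₚ r n)))

  -ₚ-inverseˡ : ∀ p → (-ₚ p) +ₚ p ≋ []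
  -ₚ-inverseˡ p = mk λ n → trans (coeff-+ₚ (-ₚ p) p n) (trans (+-congʳ (coeff--ₚ p n)) (-‿inverseˡ _))

  -ₚ-inverseʳ : ∀ p → p +ₚ (-ₚ p) ≋ []
  -ₚ-inverseʳ p = mk λ n → trans (coeff-+ₚ p (-ₚ p) n) (trans (+-congˡ (coeff--ₚ p n)) (-‿inverseʳ _))

  ·ₚ-cong : ∀ {a b p r} → a ≈ b → p ≋ r → a ·ₚ p ≋ b ·ₚ r
  ·ₚ-cong {a} {b} {p} {r} a≈b (mk e) =
    mk λ n → trans (coeff-·ₚ a p n) (trans (*-cong a≈b (e n)) (sym (coeff-·ₚ b r n)))

  ·ₚ-distribˡ : ∀ a p r → a ·ₚ (p +ₚ r) ≋ a ·ₚ p +ₚ a ·ₚ r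
  ·ₚ-distribˡ a p r = mk λ n → begin
    coeff (a ·ₚ (p +ₚ r)) n         ≈⟨ trans (coeff-·ₚ a (p +ₚ r) n) (*-congˡ (coeff-+ₚ p r n)) ⟩
    a * (coeff p n + coeff r n)     ≈⟨ distribˡ _ _ _ ⟩
    a * coeff p n + a * coeff r n   ≈⟨ sym (trans (coeff-+ₚ (a ·ₚ p) (a ·ₚ r) n) (+-cong (coeff-·ₚ a p n) (coeff-·ₚ a r n))) ⟩
    coeff (a ·ₚ p +ₚ a ·ₚ r) n      ∎
    where open ≈-Reasoning

  ·ₚ-distribʳ : ∀ a b p → (a + b) ·ₚ p ≋ a ·ₚ p +ₚ b ·ₚ p
  ·ₚ-distribʳ a b p = mk λ n → begin
    coeff ((a + b) ·ₚ p) n          ≈⟨ coeff-·ₚ (a + b) p n ⟩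
    (a + b) * coeff p n             ≈⟨ distribʳ _ _ _ ⟩
    a * coeff p n + b * coeff p n   ≈⟨ sym (trans (coeff-+ₚ (a ·ₚ p) (b ·ₚ p) n) (+-cong (coeff-·ₚ a p n) (coeff-·ₚ b p n))) ⟩
    coeff (a ·ₚ p +ₚ b ·ₚ p) n      ∎
    where open ≈-Reasoning

  ·ₚ-assoc : ∀ a b p → a ·ₚ (b ·ₚ p) ≋ (a * b) ·ₚ p
  ·ₚ-assoc a b p = mk λ n → begin
    coeff (a ·ₚ (b ·ₚ p)) n  ≈⟨ trans (coeff-·ₚ a (b ·ₚ p) n) (*-congˡ (coeff-·ₚ b p n)) ⟩
    a * (b * coeff p n)      ≈⟨ sym (*-assoc _ _ _) ⟩
    (a * b) * coeff p n      ≈⟨ sym (coeff-·ₚ (a * b) p n) ⟩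
    coeff ((a * b) ·ₚ p) n   ∎
    where open ≈-Reasoning

  ·ₚ-zeroˡ : ∀ {a} p → a ≈ 0# → a ·ₚ p ≋ []
  ·ₚ-zeroˡ {a} p a≈0 = mk λ n → trans (coeff-·ₚ a p n) (trans (*-congʳ a≈0) (zeroˡ _))

  ·ₚ-identityˡ : ∀ p → 1# ·ₚ p ≋ p
  ·ₚ-identityˡ p = mk λ n → trans (coeff-·ₚ 1# p n) (*-identityˡ _)

  shift : Pol → Pol
  shift p = 0# ∷ p

  shift-+ₚ : ∀ p r → shift (p +ₚ r) ≋ shift p +ₚ shift r
  shift-+ₚ p r = ∷-cong (sym (+-identityʳ _)) ≋-refl

  ·ₚ-shift : ∀ a p → a ·ₚ shift p ≋ shift (a ·ₚ p)
  ·ₚ-shift a p = ∷-cong (zeroʳ a) ≋-refl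

  ∷-split : ∀ a p → (a ∷ p) ≋ (a ∷ []) +ₚ shift p
  ∷-split a p = ∷-cong (sym (+-identityʳ a)) ≋-refl

  *ₚ-zeroˡ : ∀ {p} r → p ≋ [] → p *ₚ r ≋ []
  *ₚ-zeroˡ {[]}    r p≋[] = ≋-refl
  *ₚ-zeroˡ {a ∷ p} r p≋[] =
    ≋-trans (+ₚ-cong (·ₚ-zeroˡ r (∷-≋[]-head p≋[])) (∷-cong refl (*ₚ-zeroˡ r (∷-≋[]-tail p≋[]))))
                                     (∷-≋[] refl ≋-refl)

  *ₚ-zeroʳ : ∀ p → p *ₚ [] ≋ []
  *ₚ-zeroʳ []      = ≋-refl
  *ₚ-zeroʳ (a ∷ p) = ∷-≋[] refl (*ₚ-zeroʳ p)

  *ₚ-congˡ : ∀ {p p′} r → p ≋ p′ → p *ₚ r ≋ p′ *ₚ r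
  *ₚ-congˡ {[]}    {p′}     r e = ≋-sym (*ₚ-zeroˡ r (≋-sym e))
  *ₚ-congˡ {a ∷ p} {[]}     r e = *ₚ-zeroˡ r e
  *ₚ-congˡ {a ∷ p} {b ∷ p′} r e = +ₚ-cong (·ₚ-cong (∷-head e) ≋-refl) (∷-cong refl (*ₚ-congˡ r (∷-tail e)))

  *ₚ-congʳ : ∀ p {r r′} → r ≋ r′ → p *ₚ r ≋ p *ₚ r′
  *ₚ-congʳ []      e = ≋-refl
  *ₚ-congʳ (a ∷ p) e = +ₚ-cong (·ₚ-cong refl e) (∷-cong refl (*ₚ-congʳ p e))

  *ₚ-cong : ∀ {p p′ r r′} → p ≋ p′ → r ≋ r′ → p *ₚ r ≋ p′ *ₚ r′
  *ₚ-cong {p} {p′} {r} e f = ≋-trans (*ₚ-congˡ r e) (*ₚ-congʳ p′ f)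

  +ₚ-interchange : ∀ p r s u → (p +ₚ r) +ₚ (s +ₚ u) ≋ (p +ₚ s) +ₚ (r +ₚ u)
  +ₚ-interchange p r s u = mk λ n → begin
    coeff ((p +ₚ r) +ₚ (s +ₚ u)) n
      ≈⟨ trans (coeff-+ₚ (p +ₚ r) (s +ₚ u) n) (+-cong (coeff-+ₚ p r n) (coeff-+ₚ s u n)) ⟩
    (coeff p n + coeff r n) + (coeff s n + coeff u n)
      ≈⟨ interchange _ _ _ _ ⟩
    (coeff p n + coeff s n) + (coeff r n + coeff u n)
      ≈⟨ sym (trans (coeff-+ₚ (p +ₚ s) (r +ₚ u) n) (+-cong (coeff-+ₚ p s n) (coeff-+ₚ r u n))) ⟩
    coeff ((p +ₚ s) +ₚ (r +ₚ u)) n ∎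
    where
    open ≈-Reasoning
    open import Algebra.Properties.CommutativeSemigroup +-commutativeSemigroup using (interchange)

  *ₚ-distribˡ : ∀ p r s → p *ₚ (r +ₚ s) ≋ p *ₚ r +ₚ p *ₚ s
  *ₚ-distribˡ []      r s = ≋-refl
  *ₚ-distribˡ (a ∷ p) r s =
    ≋-trans (+ₚ-cong (·ₚ-distribˡ a r s) (≋-trans (∷-cong refl (*ₚ-distribˡ p r s)) (shift-+ₚ (p *ₚ r) (p *ₚ s))))
            (+ₚ-interchange (a ·ₚ r) (a ·ₚ s) (shift (p *ₚ r)) (shift (p *ₚ s)))

  *ₚ-distribʳ : ∀ p r s → (r +ₚ s) *ₚ p ≋ r *ₚ p +ₚ s *ₚ p
  *ₚ-distribʳ p []      s       = ≋-refl
  *ₚ-distribʳ p (a ∷ r) []      = ≋-sym (+ₚ-identityʳ _)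
  *ₚ-distribʳ p (a ∷ r) (b ∷ s) =
    ≋-trans (+ₚ-cong (·ₚ-distribʳ a b p) (≋-trans (∷-cong refl (*ₚ-distribʳ p r s)) (shift-+ₚ (r *ₚ p) (s *ₚ p))))
            (+ₚ-interchange (a ·ₚ p) (b ·ₚ p) (shift (r *ₚ p)) (shift (s *ₚ p)))

  ·ₚ-*ₚ : ∀ a p r → a ·ₚ (p *ₚ r) ≋ (a ·ₚ p) *ₚ r
  ·ₚ-*ₚ a []      r = ≋-refl
  ·ₚ-*ₚ a (b ∷ p) r = ≋-trans (·ₚ-distribˡ a (b ·ₚ r) (shift (p *ₚ r)))
                              (+ₚ-cong (·ₚ-assoc a b r) (≋-trans (·ₚ-shift a (p *ₚ r)) (∷-cong refl (·ₚ-*ₚ a p r))))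

  *ₚ-shiftˡ : ∀ p r → shift p *ₚ r ≋ shift (p *ₚ r)
  *ₚ-shiftˡ p r = +ₚ-cong (·ₚ-zeroˡ r refl) ≋-refl

  *ₚ-shiftʳ : ∀ p r → p *ₚ shift r ≋ shift (p *ₚ r)
  *ₚ-shiftʳ []      r = ≋-sym (∷-≋[] refl ≋-refl)
  *ₚ-shiftʳ (a ∷ p) r = ≋-trans (+ₚ-cong (·ₚ-shift a r) (∷-cong refl (*ₚ-shiftʳ p r)))
                                (≋-sym (shift-+ₚ (a ·ₚ r) (shift (p *ₚ r))))

  *ₚ-assoc : ∀ p r s → (p *ₚ r) *ₚ s ≋ p *ₚ (r *ₚ s)
  *ₚ-assoc []      r s = ≋-refl
  *ₚ-assoc (a ∷ p) r s =
    ≋-trans (*ₚ-distribʳ s (a ·ₚ r) (shift (p *ₚ r)))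
            (+ₚ-cong (≋-sym (·ₚ-*ₚ a r s)) (≋-trans (*ₚ-shiftˡ (p *ₚ r) s) (∷-cong refl (*ₚ-assoc p r s))))

  *ₚ-const : ∀ a p → (a ∷ []) *ₚ p ≋ a ·ₚ p
  *ₚ-const a p = ≋-trans (+ₚ-cong ≋-refl (∷-≋[] refl ≋-refl)) (+ₚ-identityʳ (a ·ₚ p))

  *ₚ-identityˡ : ∀ p → 1ₚ *ₚ p ≋ p
  *ₚ-identityˡ p = ≋-trans (*ₚ-const 1# p) (·ₚ-identityˡ p)

  const-*ₚ-comm : ∀ a p → (a ∷ []) *ₚ p ≋ p *ₚ (a ∷ [])
  const-*ₚ-comm a []      = ∷-≋[] refl ≋-refl
  const-*ₚ-comm a (b ∷ p) = ≋-trans (*ₚ-const a (b ∷ p))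
    (∷-cong (trans (*-comm a b) (sym (+-identityʳ _))) (≋-trans (≋-sym (*ₚ-const a p)) (const-*ₚ-comm a p)))

  *ₚ-comm : ∀ p r → p *ₚ r ≋ r *ₚ p
  *ₚ-comm []      r = ≋-sym (*ₚ-zeroʳ r)
  *ₚ-comm (a ∷ p) r = begin
    a ·ₚ r +ₚ shift (p *ₚ r)        ≈⟨ +ₚ-cong (≋-sym (*ₚ-const a r)) (∷-cong refl (*ₚ-comm p r)) ⟩
    (a ∷ []) *ₚ r +ₚ shift (r *ₚ p) ≈⟨ +ₚ-cong (const-*ₚ-comm a r) (≋-sym (*ₚ-shiftʳ r p)) ⟩
    r *ₚ (a ∷ []) +ₚ r *ₚ shift p   ≈⟨ ≋-sym (*ₚ-distribˡ r (a ∷ []) (shift p)) ⟩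
    r *ₚ ((a ∷ []) +ₚ shift p)      ≈⟨ *ₚ-congʳ r (≋-sym (∷-split a p)) ⟩
    r *ₚ (a ∷ p)                    ∎
    where open ≋-Reasoning

  polyRing : CommutativeRing c ℓ
  polyRing = record
    { Carrier = Pol
    ; _≈_ = _≋_
    ; _+_ = _+ₚ_
    ; _*_ = _*ₚ_
    ; -_ = -ₚ_
    ; 0# = []
    ; 1# = 1ₚ
    ; isCommutativeRing = record
      { isRing = record
        { +-isAbelianGroup = record
          { isGroup = record
            { isMonoid = record
              { isSemigroup = record
                { isMagma = record { isEquivalence = Setoid.isEquivalence ≋-setoid ; ∙-cong = +ₚ-cong }
                ; assoc = +ₚ-assoc }
              ; identity = +ₚ-identityˡ , +ₚ-identityʳ }
            ; inverse = -ₚ-inverseˡ , -ₚ-inverseʳ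
            ; ⁻¹-cong = -ₚ-cong }
          ; comm = +ₚ-comm }
        ; *-cong = *ₚ-cong
        ; *-assoc = *ₚ-assoc
        ; *-identity = *ₚ-identityˡ , λ p → ≋-trans (*ₚ-comm p 1ₚ) (*ₚ-identityˡ p)
        ; distrib = *ₚ-distribˡ , *ₚ-distribʳ }
      ; *-comm = *ₚ-comm }
    }

module PolynomialBasics {c ℓ : Level} (F : FiniteField c ℓ) where

  open import Data.Nat using () renaming (_+_ to _+ℕ_)

  open FiniteField F hiding (zero)
  open Poly F
  open PolynomialRing F
  open Algebra.Properties.Ring ring using (-0#≈0#)
  module 𝔽[X] = CommutativeRing polyRing
  module 𝔽[X]-Solver = CommutativeRingSolver polyRing
  module 𝔽[X]-Properties = Algebra.Properties.Ring 𝔽[X].ring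
  module ∏ₚ = Products 𝔽[X].commutativeSemiring

  const : Carrier → Pol
  const a = a ∷ []

  X : Pol
  X = 0# ∷ 1# ∷ []

  infix 8 X-_
  X-_ : Carrier → Pol
  X- a = (- a) ∷ 1# ∷ []

  X^ : ℕ → Pol
  X^ zero    = 1ₚ
  X^ (suc j) = shift (X^ j)

  infix 7 _·X^_
  _·X^_ : Carrier → ℕ → Pol
  a ·X^ m = const a *ₚ X^ m

  const-cong : ∀ {a b} → a ≈ b → const a ≋ const b
  const-cong a≈b = ∷-cong a≈b ≋-refl

  const-*ₚ : ∀ a b → const (a * b) ≋ const a *ₚ const b
  const-*ₚ a b = ≋-sym (*ₚ-const a (b ∷ []))

  X*ₚ : ∀ p → X *ₚ p ≋ shift p
  X*ₚ p = ≋-trans (+ₚ-cong (·ₚ-zeroˡ p refl) (∷-cong refl (*ₚ-const 1# p))) (∷-cong refl (·ₚ-identityˡ p))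

  ∷-≋-X : ∀ a p → (a ∷ p) ≋ const a +ₚ X *ₚ p
  ∷-≋-X a p = ≋-trans (∷-split a p) (+ₚ-cong (≋-refl {const a}) (≋-sym (X*ₚ p)))

  X-≋X-const : ∀ a → X- a ≋ X -ₚ const a
  X-≋X-const a = mk λ { zero → sym (+-identityˡ _) ; (suc n) → refl }

  *ₚ-X- : ∀ p a → p *ₚ X- a ≋ shift p -ₚ a ·ₚ p
  *ₚ-X- p a = ≋-trans (*ₚ-congʳ p (X-≋X-const a))
    (≋-trans (𝔽[X]-Solver.solve 3 (λ p x k → p :* (x :- k) := x :* p :- k :* p) ≋-refl p X (const a))
             (+ₚ-cong (X*ₚ p) (-ₚ-cong (*ₚ-const a p))))
    where open 𝔽[X]-Solver using (_:*_; _:-_; _:=_)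

  coeff-X^-≡ : ∀ n → coeff (X^ n) n ≈ 1#
  coeff-X^-≡ zero    = refl
  coeff-X^-≡ (suc n) = coeff-X^-≡ n

  coeff-X^-≢ : ∀ {n j} → n ≢ j → coeff (X^ n) j ≈ 0#
  coeff-X^-≢ {zero}  {zero}  0≢0     = ⊥-elim (0≢0 ≡.refl)
  coeff-X^-≢ {zero}  {suc j} _       = refl
  coeff-X^-≢ {suc n} {zero}  _       = refl
  coeff-X^-≢ {suc n} {suc j} 1+n≢1+j = coeff-X^-≢ (λ n≡j → 1+n≢1+j (≡.cong suc n≡j))

  coeff-X^-+ : ∀ m j → coeff (X^ m) (m +ℕ j) ≈ coeff 1ₚ j
  coeff-X^-+ zero    j = refl
  coeff-X^-+ (suc m) j = coeff-X^-+ m j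

  Monic : Pol → ℕ → Set ℓ
  Monic p n = coeff p n ≈ 1# × (∀ j → n < j → coeff p j ≈ 0#)

  monic-1ₚ : Monic 1ₚ 0
  monic-1ₚ = refl , λ { (suc j) _ → refl }

  coeff-*ₚX- : ∀ p a j → coeff (p *ₚ X- a) j ≈ coeff (shift p) j - a * coeff p j
  coeff-*ₚX- p a j = trans (coeff-≈ (*ₚ-X- p a) j) (trans (coeff-+ₚ (shift p) (-ₚ (a ·ₚ p)) j)
                       (+-congˡ (trans (coeff--ₚ (a ·ₚ p) j) (-‿cong (coeff-·ₚ a p j)))))

  monic-*ₚX- : ∀ {n} p a → Monic p n → Monic (p *ₚ X- a) (suc n)
  monic-*ₚX- {n} p a (pₙ≈1 , p>n≈0) = top , above
    where
    minus-a*0 : ∀ {y z} → z ≈ 0# → y - a * z ≈ y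
    minus-a*0 z≈0 = trans (+-congˡ (trans (-‿cong (trans (*-congˡ z≈0) (zeroʳ a))) -0#≈0#)) (+-identityʳ _)
    top : coeff (p *ₚ X- a) (suc n) ≈ 1#
    top = trans (coeff-*ₚX- p a (suc n)) (trans (minus-a*0 (p>n≈0 (suc n) (ℕ.n<1+n n))) pₙ≈1)
    above : ∀ j → suc n < j → coeff (p *ₚ X- a) j ≈ 0#
    above (suc j) (s≤s n<j) =
      trans (coeff-*ₚX- p a (suc j)) (trans (minus-a*0 (p>n≈0 (suc j) (ℕ.m<n⇒m<1+n n<j))) (p>n≈0 j n<j))

  monic-∏X- : ∀ n (f : ℕ → Carrier) → Monic (∏ₚ.∏< n (λ j → X- f j)) n
  monic-∏X- zero    f = monic-1ₚ
  monic-∏X- (suc n) f = monic-*ₚX- (∏ₚ.∏< n (λ j → X- f j)) (f n) (monic-∏X- n f)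

  monic-X^+ₚ : ∀ n r → (∀ j → n ≤ j → coeff r j ≈ 0#) → Monic (X^ n +ₚ r) n
  monic-X^+ₚ n r r≥n≈0 = top , above
    where
    top : coeff (X^ n +ₚ r) n ≈ 1#
    top = trans (coeff-+ₚ (X^ n) r n) (trans (+-cong (coeff-X^-≡ n) (r≥n≈0 n ℕ.≤-refl)) (+-identityʳ _))
    above : ∀ j → n < j → coeff (X^ n +ₚ r) j ≈ 0#
    above j n<j = trans (coeff-+ₚ (X^ n) r j)
      (trans (+-cong (coeff-X^-≢ (ℕ.<⇒≢ n<j)) (r≥n≈0 j (ℕ.<⇒≤ n<j))) (+-identityʳ _))

  length-+ₚ : ∀ {m} p r → length p ≤ m → length r ≤ m → length (p +ₚ r) ≤ m
  length-+ₚ []      r       p≤m         r≤m         = r≤m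
  length-+ₚ (a ∷ p) []      p≤m         r≤m         = p≤m
  length-+ₚ (a ∷ p) (b ∷ r) (s≤s p≤m) (s≤s r≤m) = s≤s (length-+ₚ p r p≤m r≤m)

  length-*ₚX- : ∀ p a → length (p *ₚ X- a) ≤ suc (length p)
  length-*ₚX- []      a = z≤n
  length-*ₚX- (b ∷ p) a = length-+ₚ (b ·ₚ X- a) (shift (p *ₚ X- a)) (s≤s (s≤s z≤n)) (s≤s (length-*ₚX- p a))

  length-∏X- : ∀ n (f : ℕ → Carrier) → length (∏ₚ.∏< n (λ j → X- f j)) ≤ suc n
  length-∏X- zero    f = s≤s z≤n
  length-∏X- (suc n) f = ℕ.≤-trans (length-*ₚX- (∏ₚ.∏< n (λ j → X- f j)) (f n)) (s≤s (length-∏X- n f))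

  take-≋ : ∀ n p → (∀ j → n ≤ j → coeff p j ≈ 0#) → take n p ≋ p
  take-≋ zero    p       p≥0≈0 = ≋-sym (mk λ j → p≥0≈0 j z≤n)
  take-≋ (suc n) []      _     = ≋-refl
  take-≋ (suc n) (a ∷ p) p≥n≈0 = ∷-cong refl (take-≋ n p (λ j n≤j → p≥n≈0 (suc j) (s≤s n≤j)))

module Evaluation {c ℓ : Level} (F : FiniteField c ℓ) where

  open FiniteField F hiding (zero)
  open Poly F
  open PolynomialRing F
  open FieldProperties F
  open PolynomialBasics F
  open Algebra.Properties.Ring ring using (-0#≈0#; -‿involutive)
  open Algebra.Properties.Semiring.Exp semiring using (_^_)
  private module ≈-Reasoning = Relation.Binary.Reasoning.Setoid setoid
  module 𝔽-Solver = CommutativeRingSolver commRing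
  module ∏ᶠ = Products commutativeSemiring

  eval : Pol → Carrier → Carrier
  eval []      x = 0#
  eval (a ∷ p) x = a + x * eval p x

  eval-+ₚ : ∀ p r x → eval (p +ₚ r) x ≈ eval p x + eval r x
  eval-+ₚ []      r       x = sym (+-identityˡ _)
  eval-+ₚ (a ∷ p) []      x = sym (+-identityʳ _)
  eval-+ₚ (a ∷ p) (b ∷ r) x = begin
    (a + b) + x * eval (p +ₚ r) x
      ≈⟨ +-congˡ (*-congˡ (eval-+ₚ p r x)) ⟩
    (a + b) + x * (eval p x + eval r x)
      ≈⟨ solve 5 (λ a b x u v → (a :+ b) :+ x :* (u :+ v) := (a :+ x :* u) :+ (b :+ x :* v)) refl a b x (eval p x) (eval r x) ⟩
    (a + x * eval p x) + (b + x * eval r x) ∎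
    where
    open ≈-Reasoning
    open 𝔽-Solver

  eval-·ₚ : ∀ a p x → eval (a ·ₚ p) x ≈ a * eval p x
  eval-·ₚ a []      x = sym (zeroʳ _)
  eval-·ₚ a (b ∷ p) x = trans (+-congˡ (*-congˡ (eval-·ₚ a p x)))
    (solve 4 (λ a b x u → a :* b :+ x :* (a :* u) := a :* (b :+ x :* u)) refl a b x (eval p x))
    where open 𝔽-Solver

  eval--ₚ : ∀ p x → eval (-ₚ p) x ≈ - eval p x
  eval--ₚ []      x = sym -0#≈0#
  eval--ₚ (b ∷ p) x = trans (+-congˡ (*-congˡ (eval--ₚ p x)))
    (solve 3 (λ b x u → :- b :+ x :* (:- u) := :- (b :+ x :* u)) refl b x (eval p x))
    where open 𝔽-Solver

  eval-≋[] : ∀ {p} x → p ≋ [] → eval p x ≈ 0#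
  eval-≋[] {[]}    x p≋[] = refl
  eval-≋[] {a ∷ p} x p≋[] =
    trans (+-cong (∷-≋[]-head p≋[]) (*-congˡ (eval-≋[] x (∷-≋[]-tail p≋[])))) (trans (+-identityˡ _) (zeroʳ _))

  eval-cong : ∀ {p r} x → p ≋ r → eval p x ≈ eval r x
  eval-cong {p} {r} x p≋r = x-y≈0⇒x≈y (begin
    eval p x - eval r x      ≈⟨ +-congˡ (sym (eval--ₚ r x)) ⟩
    eval p x + eval (-ₚ r) x ≈⟨ sym (eval-+ₚ p (-ₚ r) x) ⟩
    eval (p -ₚ r) x          ≈⟨ eval-≋[] x (≋-trans (+ₚ-cong p≋r ≋-refl) (-ₚ-inverseʳ r)) ⟩
    0#                       ∎)
    where open ≈-Reasoning

  eval-*ₚ : ∀ p r x → eval (p *ₚ r) x ≈ eval p x * eval r x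
  eval-*ₚ []      r x = sym (zeroˡ _)
  eval-*ₚ (a ∷ p) r x = begin
    eval (a ·ₚ r +ₚ shift (p *ₚ r)) x
      ≈⟨ eval-+ₚ (a ·ₚ r) (shift (p *ₚ r)) x ⟩
    eval (a ·ₚ r) x + (0# + x * eval (p *ₚ r) x)
      ≈⟨ +-cong (eval-·ₚ a r x) (trans (+-identityˡ _) (*-congˡ (eval-*ₚ p r x))) ⟩
    a * eval r x + x * (eval p x * eval r x)
      ≈⟨ solve 4 (λ a x u v → a :* v :+ x :* (u :* v) := (a :+ x :* u) :* v) refl a x (eval p x) (eval r x) ⟩
    (a + x * eval p x) * eval r x ∎
    where
    open ≈-Reasoning
    open 𝔽-Solver

  eval-const : ∀ a x → eval (const a) x ≈ a
  eval-const a x = trans (+-congˡ (zeroʳ _)) (+-identityʳ _)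

  eval-X- : ∀ a x → eval (X- a) x ≈ x - a
  eval-X- a x = trans (+-congˡ (trans (*-congˡ (eval-const 1# x)) (*-identityʳ _))) (+-comm _ _)

  eval-X^ : ∀ j x → eval (X^ j) x ≈ x ^ j
  eval-X^ zero    x = eval-const 1# x
  eval-X^ (suc j) x = trans (+-identityˡ _) (*-congˡ (eval-X^ j x))

  -- Synthetic division by X - c.
  divide : Carrier → Pol → Pol × Carrier
  divide c []          = [] , 0#
  divide c (d ∷ [])    = [] , d
  divide c (d ∷ e ∷ p) = (proj₂ (divide c (e ∷ p)) ∷ proj₁ (divide c (e ∷ p))) , d + c * proj₂ (divide c (e ∷ p))

  divide-≋ : ∀ c p → p ≋ proj₁ (divide c p) *ₚ X- c +ₚ const (proj₂ (divide c p))
  divide-≋ c []          = ≋-sym (∷-≋[] refl ≋-refl)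
  divide-≋ c (d ∷ [])    = ≋-refl
  divide-≋ c (d ∷ e ∷ p) = begin
    d ∷ u
      ≈⟨ ∷-≋-X d u ⟩
    const d +ₚ X *ₚ u
      ≈⟨ +ₚ-cong (≋-refl {const d}) (*ₚ-congʳ X (≋-trans (divide-≋ c (e ∷ p)) (+ₚ-cong (*ₚ-congʳ q′ (X-≋X-const c)) ≋-refl))) ⟩
    const d +ₚ X *ₚ (q′ *ₚ (X -ₚ const c) +ₚ const r′)
      ≈⟨ solve 5 (λ D x q r k → D :+ x :* (q :* (x :- k) :+ r) := (r :+ x :* q) :* (x :- k) :+ (D :+ k :* r)) ≋-refl (const d) X q′ (const r′) (const c) ⟩
    (const r′ +ₚ X *ₚ q′) *ₚ (X -ₚ const c) +ₚ (const d +ₚ const c *ₚ const r′)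
      ≈⟨ ≋-sym (+ₚ-cong (*ₚ-cong (∷-≋-X r′ q′) (X-≋X-const c)) (+ₚ-cong (≋-refl {const d}) (const-*ₚ c r′))) ⟩
    (r′ ∷ q′) *ₚ X- c +ₚ const (d + c * r′) ∎
    where
    open ≋-Reasoning
    open 𝔽[X]-Solver
    u = e ∷ p
    q′ = proj₁ (divide c u)
    r′ = proj₂ (divide c u)

  length-divide : ∀ c d p → length (proj₁ (divide c (d ∷ p))) ≡ length p
  length-divide c d []      = ≡.refl
  length-divide c d (e ∷ p) = ≡.cong suc (length-divide c e p)

  eval-divide : ∀ c p x → eval p x ≈ eval (proj₁ (divide c p)) x * (x - c) + proj₂ (divide c p)
  eval-divide c p x = begin
    eval p x
      ≈⟨ eval-cong x (divide-≋ c p) ⟩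
    eval (q′ *ₚ X- c +ₚ const r′) x
      ≈⟨ eval-+ₚ (q′ *ₚ X- c) (const r′) x ⟩
    eval (q′ *ₚ X- c) x + eval (const r′) x
      ≈⟨ +-cong (trans (eval-*ₚ q′ (X- c) x) (*-congˡ (eval-X- c x))) (eval-const r′ x) ⟩
    eval q′ x * (x - c) + r′ ∎
    where
    open ≈-Reasoning
    q′ = proj₁ (divide c p)
    r′ = proj₂ (divide c p)

  remainder-theorem : ∀ c p → proj₂ (divide c p) ≈ eval p c
  remainder-theorem c p =
    sym (trans (eval-divide c p c) (trans (+-congʳ (trans (*-congˡ (-‿inverseʳ c)) (zeroʳ _))) (+-identityˡ _)))

  vanishing⇒≋[] : ∀ m p → length p ≤ m → (xs : Fin m → Carrier) → (∀ i j → xs i ≈ xs j → i ≡ j) →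
                  (∀ i → eval p (xs i) ≈ 0#) → p ≋ []
  vanishing⇒≋[] m       []      _          _  _        _      = ≋-refl
  vanishing⇒≋[] (suc m) (d ∷ p) (s≤s p≤m) xs distinct vanish = begin
    d ∷ p                   ≈⟨ divide-≋ x₀ (d ∷ p) ⟩
    q′ *ₚ X- x₀ +ₚ const r′ ≈⟨ +ₚ-cong (*ₚ-zeroˡ (X- x₀) q′≋[]) (∷-≋[] r′≈0 ≋-refl) ⟩
    []                      ∎
    where
    open ≋-Reasoning
    x₀ = xs fzero
    q′ = proj₁ (divide x₀ (d ∷ p))
    r′ = proj₂ (divide x₀ (d ∷ p))
    r′≈0 : r′ ≈ 0#
    r′≈0 = trans (remainder-theorem x₀ (d ∷ p)) (vanish fzero)
    q′-vanish : ∀ i → eval q′ (xs (fsuc i)) ≈ 0#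
    q′-vanish i = x*y≈0∧y≉0⇒x≈0
      (trans (sym (+-identityʳ _)) (trans (+-congˡ (sym r′≈0)) (trans (sym (eval-divide x₀ (d ∷ p) _)) (vanish (fsuc i)))))
      (λ xᵢ-x₀≈0 → case distinct (fsuc i) fzero (x-y≈0⇒x≈y xᵢ-x₀≈0) of λ ())
    q′≋[] : q′ ≋ []
    q′≋[] = vanishing⇒≋[] m q′ (≡.subst (_≤ m) (≡.sym (length-divide x₀ d p)) p≤m) (λ i → xs (fsuc i))
              (λ i j e → Fin.suc-injective (distinct (fsuc i) (fsuc j) e)) q′-vanish

  -- p - r has at most q coefficients and vanishes at the q elements of 𝔽_q.
  monic-eval⇒≋ : ∀ {p r} → Monic p q → Monic r q → (∀ x → eval p x ≈ eval r x) → p ≋ r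
  monic-eval⇒≋ {p} {r} (pq≈1 , p>q≈0) (rq≈1 , r>q≈0) p≗r =
    𝔽[X]-Properties.x∙y⁻¹≈ε⇒x≈y p r
      (≋-trans (≋-sym truncate) (vanishing⇒≋[] q (take q d) length≤q enum enum-injective roots))
    where
    d = p -ₚ r
    d≥q≈0 : ∀ j → q ≤ j → coeff d j ≈ 0#
    d≥q≈0 j q≤j with ℕ.m≤n⇒m<n∨m≡n q≤j
    ... | inj₁ q<j    = trans (coeff-+ₚ p (-ₚ r) j)
      (trans (+-cong (p>q≈0 j q<j) (trans (coeff--ₚ r j) (trans (-‿cong (r>q≈0 j q<j)) -0#≈0#))) (+-identityʳ _))
    ... | inj₂ ≡.refl = trans (coeff-+ₚ p (-ₚ r) q) (trans (+-cong (trans pq≈1 (sym rq≈1)) (coeff--ₚ r q)) (-‿inverseʳ _))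
    truncate : take q d ≋ d
    truncate = take-≋ q d d≥q≈0
    length≤q : length (take q d) ≤ q
    length≤q = ≡.subst (_≤ q) (≡.sym (List.length-take q d)) (ℕ.m⊓n≤m q (length d))
    roots : ∀ i → eval (take q d) (enum i) ≈ 0#
    roots i = trans (eval-cong (enum i) truncate) (trans (eval-+ₚ p (-ₚ r) _) (trans (+-cong (p≗r (enum i)) (eval--ₚ r _)) (-‿inverseʳ _)))

  eval-∏< : ∀ n (g : ℕ → Pol) x → eval (∏ₚ.∏< n g) x ≈ ∏ᶠ.∏< n (λ j → eval (g j) x)
  eval-∏< zero    g x = eval-const 1# x
  eval-∏< (suc n) g x = trans (eval-*ₚ (∏ₚ.∏< n g) (g n) x) (*-congʳ (eval-∏< n g x))

  eval-∏X- : ∀ n (f : ℕ → Carrier) x → eval (∏ₚ.∏< n (λ j → X- f j)) x ≈ ∏ᶠ.∏< n (λ j → x - f j)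
  eval-∏X- n f x = trans (eval-∏< n (λ j → X- f j) x) (∏ᶠ.∏<-cong n (λ j → eval-X- (f j) x))

  -- Every element of 𝔽_q is a root of both sides (Fermat).
  ∏X-digit≋X^q-X : ∏ₚ.∏< q (λ j → X- digit j) ≋ X^ q -ₚ X^ 1
  ∏X-digit≋X^q-X = monic-eval⇒≋ (monic-∏X- q digit) (monic-X^+ₚ q (-ₚ X^ 1) lower) values
    where
    lower : ∀ j → q ≤ j → coeff (-ₚ X^ 1) j ≈ 0#
    lower j q≤j = trans (coeff--ₚ (X^ 1) j) (trans (-‿cong (coeff-X^-≢ (ℕ.<⇒≢ (ℕ.<-≤-trans (s≤s (s≤s z≤n)) q≤j)))) -0#≈0#)
    values : ∀ x → eval (∏ₚ.∏< q (λ j → X- digit j)) x ≈ eval (X^ q -ₚ X^ 1) x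
    values x = begin
      eval (∏ₚ.∏< q (λ j → X- digit j)) x
        ≈⟨ eval-∏X- q digit x ⟩
      ∏ᶠ.∏< q (λ j → x - digit j)
        ≈⟨ ∏ᶠ.∏<-zero q (toℕ (index x)) (Fin.toℕ<n (index x)) (x-y≈0 (sym (digit-index x))) ⟩
      0#
        ≈⟨ sym (-‿inverseʳ x) ⟩
      x - x
        ≈⟨ sym (+-cong (trans (eval-X^ q x) (fermat x)) (trans (eval--ₚ (X^ 1) x) (-‿cong (trans (eval-X^ 1 x) (*-identityʳ x))))) ⟩
      eval (X^ q) x + eval (-ₚ X^ 1) x
        ≈⟨ sym (eval-+ₚ (X^ q) (-ₚ X^ 1) x) ⟩
      eval (X^ q -ₚ X^ 1) x ∎
      where
      open ≈-Reasoning
      x-y≈0 : ∀ {y z} → y ≈ z → y - z ≈ 0#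
      x-y≈0 y≈z = trans (+-congʳ y≈z) (-‿inverseʳ _)

  [X+1]^q≋X^q+1 : ∏ₚ.∏< q (λ _ → X- (- 1#)) ≋ X^ q +ₚ 1ₚ
  [X+1]^q≋X^q+1 = monic-eval⇒≋ (monic-∏X- q (λ _ → - 1#)) (monic-X^+ₚ q 1ₚ lower) values
    where
    lower : ∀ j → q ≤ j → coeff 1ₚ j ≈ 0#
    lower j q≤j = coeff-X^-≢ (ℕ.<⇒≢ (ℕ.<-≤-trans (s≤s z≤n) q≤j))
    values : ∀ x → eval (∏ₚ.∏< q (λ _ → X- (- 1#))) x ≈ eval (X^ q +ₚ 1ₚ) x
    values x = begin
      eval (∏ₚ.∏< q (λ _ → X- (- 1#))) x
        ≈⟨ eval-∏X- q (λ _ → - 1#) x ⟩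
      ∏ᶠ.∏< q (λ _ → x - - 1#)
        ≈⟨ ∏ᶠ.∏<-const (x - - 1#) q ⟩
      (x - - 1#) ^ q
        ≈⟨ fermat (x - - 1#) ⟩
      x - - 1#
        ≈⟨ +-cong (sym (trans (eval-X^ q x) (fermat x))) (trans (-‿involutive 1#) (sym (eval-const 1# x))) ⟩
      eval (X^ q) x + eval 1ₚ x
        ≈⟨ sym (eval-+ₚ (X^ q) 1ₚ x) ⟩
      eval (X^ q +ₚ 1ₚ) x ∎
      where open ≈-Reasoning

module Homogenisation {c ℓ c′ ℓ′ : Level} (F : FiniteField c ℓ) (S : CommutativeRing c′ ℓ′)
  {φ : FiniteField.Carrier F → CommutativeRing.Carrier S}
  (φ-hom : IsRingHomomorphism (FiniteField.rawRing F) (CommutativeRing.rawRing S) φ)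
  (u v : CommutativeRing.Carrier S) where

  module 𝔽 = FiniteField F
  open Poly F
  open PolynomialRing F
  open PolynomialBasics F using (X-_; X^; *ₚ-X-; length-∏X-; module ∏ₚ)
  open CommutativeRing S hiding (zero)
  open IsRingHomomorphism φ-hom
  open Algebra.Properties.Semiring.Exp semiring using (_^_)
  open Algebra.Properties.Ring ring using (-0#≈0#)
  open CommutativeRingSolver S using (solve; _:+_; _:*_; :-_; _:=_)
  open Relation.Binary.Reasoning.Setoid setoid
  module ∏ˢ = Products commutativeSemiring

  -- The degree-n homogenisation of p evaluated at (u, v), Σᵢ φ(pᵢ) uⁱ vⁿ⁻ⁱ, meaningful for
  -- length p ≤ n + 1 (n ∸ 1 truncates).
  H : ℕ → Pol → Carrier
  H n []      = 0#
  H n (a ∷ p) = φ a * v ^ n + u * H (n ∸ 1) p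

  H-+ₚ : ∀ n p r → H n (p +ₚ r) ≈ H n p + H n r
  H-+ₚ n []      r       = sym (+-identityˡ _)
  H-+ₚ n (a ∷ p) []      = sym (+-identityʳ _)
  H-+ₚ n (a ∷ p) (b ∷ r) = begin
    φ (a 𝔽.+ b) * v ^ n + u * H (n ∸ 1) (p +ₚ r)
      ≈⟨ +-cong (*-congʳ (+-homo a b)) (*-congˡ (H-+ₚ (n ∸ 1) p r)) ⟩
    (φ a + φ b) * v ^ n + u * (H (n ∸ 1) p + H (n ∸ 1) r)
      ≈⟨ solve 6 (λ x y V U s t → (x :+ y) :* V :+ U :* (s :+ t) := (x :* V :+ U :* s) :+ (y :* V :+ U :* t)) refl (φ a) (φ b) (v ^ n) u (H (n ∸ 1) p) (H (n ∸ 1) r) ⟩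
    (φ a * v ^ n + u * H (n ∸ 1) p) + (φ b * v ^ n + u * H (n ∸ 1) r) ∎

  H-·ₚ : ∀ n a p → H n (a ·ₚ p) ≈ φ a * H n p
  H-·ₚ n a []      = sym (zeroʳ _)
  H-·ₚ n a (b ∷ p) = begin
    φ (a 𝔽.* b) * v ^ n + u * H (n ∸ 1) (a ·ₚ p)
      ≈⟨ +-cong (*-congʳ (*-homo a b)) (*-congˡ (H-·ₚ (n ∸ 1) a p)) ⟩
    (φ a * φ b) * v ^ n + u * (φ a * H (n ∸ 1) p)
      ≈⟨ solve 5 (λ x y V U s → (x :* y) :* V :+ U :* (x :* s) := x :* (y :* V :+ U :* s)) refl (φ a) (φ b) (v ^ n) u (H (n ∸ 1) p) ⟩
    φ a * (φ b * v ^ n + u * H (n ∸ 1) p) ∎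

  H--ₚ : ∀ n p → H n (-ₚ p) ≈ - H n p
  H--ₚ n []      = sym -0#≈0#
  H--ₚ n (a ∷ p) = begin
    φ (𝔽.- a) * v ^ n + u * H (n ∸ 1) (-ₚ p)
      ≈⟨ +-cong (*-congʳ (-‿homo a)) (*-congˡ (H--ₚ (n ∸ 1) p)) ⟩
    (- φ a) * v ^ n + u * (- H (n ∸ 1) p)
      ≈⟨ solve 4 (λ x V U s → (:- x) :* V :+ U :* (:- s) := :- (x :* V :+ U :* s)) refl (φ a) (v ^ n) u (H (n ∸ 1) p) ⟩
    - (φ a * v ^ n + u * H (n ∸ 1) p) ∎

  H-≋[] : ∀ n {p} → p ≋ [] → H n p ≈ 0#
  H-≋[] n {[]}    p≋[] = refl
  H-≋[] n {a ∷ p} p≋[] = trans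
    (+-cong (trans (*-congʳ (trans (⟦⟧-cong (∷-≋[]-head p≋[])) 0#-homo)) (zeroˡ _))
            (trans (*-congˡ (H-≋[] (n ∸ 1) (∷-≋[]-tail p≋[]))) (zeroʳ _)))
    (+-identityˡ _)

  H-cong : ∀ n {p r} → p ≋ r → H n p ≈ H n r
  H-cong n {p} {r} p≋r = Algebra.Properties.Ring.x∙y⁻¹≈ε⇒x≈y ring _ _ (begin
    H n p - H n r        ≈⟨ +-congˡ (sym (H--ₚ n r)) ⟩
    H n p + H n (-ₚ r)   ≈⟨ sym (H-+ₚ n p (-ₚ r)) ⟩
    H n (p -ₚ r)         ≈⟨ H-≋[] n (≋-trans (+ₚ-cong p≋r ≋-refl) (-ₚ-inverseʳ r)) ⟩
    0#                   ∎)

  H-suc : ∀ n p → length p ≤ suc n → H (suc n) p ≈ v * H n p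
  H-suc n       []          _ = sym (zeroʳ _)
  H-suc zero    (a ∷ [])    _ = begin
    φ a * (v * v ^ 0) + u * 0#   ≈⟨ u*0-vanishes ⟩
    φ a * (v * v ^ 0)            ≈⟨ solve 3 (λ x V o → x :* (V :* o) := V :* (x :* o)) refl (φ a) v (v ^ 0) ⟩
    v * (φ a * v ^ 0)            ≈⟨ *-congˡ u*0-vanishes ⟨
    v * (φ a * v ^ 0 + u * 0#)   ∎
    where
    u*0-vanishes : ∀ {w} → w + u * 0# ≈ w
    u*0-vanishes = trans (+-congˡ (zeroʳ u)) (+-identityʳ _)
  H-suc zero    (a ∷ b ∷ p) (s≤s ())
  H-suc (suc n) (a ∷ p)     (s≤s p≤1+n) = begin
    φ a * (v * v ^ suc n) + u * H (suc n) p
      ≈⟨ +-congˡ (*-congˡ (H-suc n p p≤1+n)) ⟩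
    φ a * (v * v ^ suc n) + u * (v * H n p)
      ≈⟨ solve 5 (λ x V W U s → x :* (V :* W) :+ U :* (V :* s) := V :* (x :* W :+ U :* s)) refl (φ a) v (v ^ suc n) u (H n p) ⟩
    v * (φ a * v ^ suc n + u * H n p) ∎

  H-shift : ∀ n p → H (suc n) (shift p) ≈ u * H n p
  H-shift n p = trans (+-congʳ (trans (*-congʳ 0#-homo) (zeroˡ _))) (+-identityˡ _)

  H-*ₚX- : ∀ n p a → length p ≤ suc n → H (suc n) (p *ₚ X- a) ≈ H n p * (u - φ a * v)
  H-*ₚX- n p a p≤1+n = begin
    H (suc n) (p *ₚ X- a)
      ≈⟨ H-cong (suc n) (*ₚ-X- p a) ⟩
    H (suc n) (shift p -ₚ a ·ₚ p)
      ≈⟨ H-+ₚ (suc n) (shift p) (-ₚ (a ·ₚ p)) ⟩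
    H (suc n) (shift p) + H (suc n) (-ₚ (a ·ₚ p))
      ≈⟨ +-cong (H-shift n p) (trans (H--ₚ (suc n) (a ·ₚ p)) (-‿cong (H-·ₚ (suc n) a p))) ⟩
    u * H n p - φ a * H (suc n) p
      ≈⟨ +-congˡ (-‿cong (*-congˡ (H-suc n p p≤1+n))) ⟩
    u * H n p - φ a * (v * H n p)
      ≈⟨ solve 4 (λ U s x V → U :* s :+ :- (x :* (V :* s)) := s :* (U :+ :- (x :* V))) refl u (H n p) (φ a) v ⟩
    H n p * (u - φ a * v) ∎

  H-1ₚ : ∀ n → H n 1ₚ ≈ v ^ n
  H-1ₚ n = trans (+-cong (trans (*-congʳ 1#-homo) (*-identityˡ _)) (zeroʳ _)) (+-identityʳ _)

  H-X^ : ∀ n j → j ≤ n → H n (X^ j) ≈ u ^ j * v ^ (n ∸ j)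
  H-X^ n       zero    _         = trans (H-1ₚ n) (sym (*-identityˡ _))
  H-X^ (suc n) (suc j) (s≤s j≤n) = trans (H-shift n (X^ j)) (trans (*-congˡ (H-X^ n j j≤n)) (sym (*-assoc _ _ _)))

  H-∏X- : ∀ n (f : ℕ → 𝔽.Carrier) → H n (∏ₚ.∏< n (λ j → X- f j)) ≈ ∏ˢ.∏< n (λ j → u - φ (f j) * v)
  H-∏X- zero    f = H-1ₚ 0
  H-∏X- (suc n) f = trans (H-*ₚX- n (∏ₚ.∏< n (λ j → X- f j)) (f n) (length-∏X- n f)) (*-congʳ (H-∏X- n f))

module Frobenius {c ℓ : Level} (F : FiniteField c ℓ) where

  open FiniteField F hiding (zero)
  open Poly F
  open PolynomialRing F
  open FieldProperties F using (digit; fermat)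
  open PolynomialBasics F
  open Evaluation F using (∏X-digit≋X^q-X; [X+1]^q≋X^q+1)
  open Algebra.Properties.Semiring.Exp semiring using (_^_)
  open Algebra.Properties.Semiring.Exp 𝔽[X].semiring using (^-congˡ) renaming (_^_ to _^ₚ_)
  open Algebra.Properties.CommutativeSemiring.Exp 𝔽[X].commutativeSemiring using (^-distrib-*)
  open ≋-Reasoning

  const-isRingHomomorphism : IsRingHomomorphism rawRing 𝔽[X].rawRing const
  const-isRingHomomorphism = record
    { isSemiringHomomorphism = record
      { isNearSemiringHomomorphism = record
        { +-isMonoidHomomorphism = record
          { isMagmaHomomorphism = record
            { isRelHomomorphism = record { cong = const-cong }
            ; homo = λ a b → ≋-refl }
          ; ε-homo = ∷-≋[] refl ≋-refl }
        ; *-homo = const-*ₚ }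
      ; 1#-homo = ≋-refl }
    ; -‿homo = λ a → ≋-refl }

  module H (u v : Pol) = Homogenisation F polyRing const-isRingHomomorphism u v

  H-X^q : ∀ u v → H.H u v q (X^ q) ≋ u ^ₚ q
  H-X^q u v = ≋-trans (H.H-X^ u v q q ℕ.≤-refl)
    (≋-trans (*ₚ-congʳ (u ^ₚ q) (≋-reflexive (≡.cong (v ^ₚ_) (ℕ.n∸n≡0 q)))) (𝔽[X].*-identityʳ _))

  const[-1]*ₚ : ∀ v → const (- 1#) *ₚ v ≋ -ₚ v
  const[-1]*ₚ v = ≋-trans (*ₚ-const (- 1#) v) (mk λ n → trans (coeff-·ₚ (- 1#) v n)
                    (trans (Algebra.Properties.Ring.-1*x≈-x ring _) (sym (coeff--ₚ v n))))

  frobenius : ∀ u v → (u +ₚ v) ^ₚ q ≋ u ^ₚ q +ₚ v ^ₚ q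
  frobenius u v = begin
    (u +ₚ v) ^ₚ q
      ≈⟨ ∏ₚ.∏<-const (u +ₚ v) q ⟨
    ∏ₚ.∏< q (λ _ → u +ₚ v)
      ≈⟨ ∏ₚ.∏<-cong q (λ _ → +ₚ-cong ≋-refl (≋-sym (≋-trans (-ₚ-cong (const[-1]*ₚ v)) (𝔽[X]-Properties.-‿involutive v)))) ⟩
    ∏ₚ.∏< q (λ _ → u -ₚ const (- 1#) *ₚ v)
      ≈⟨ H.H-∏X- u v q (λ _ → - 1#) ⟨
    H.H u v q (∏ₚ.∏< q (λ _ → X- (- 1#)))
      ≈⟨ H.H-cong u v q [X+1]^q≋X^q+1 ⟩
    H.H u v q (X^ q +ₚ 1ₚ)
      ≈⟨ H.H-+ₚ u v q (X^ q) 1ₚ ⟩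
    H.H u v q (X^ q) +ₚ H.H u v q 1ₚ
      ≈⟨ +ₚ-cong (H-X^q u v) (H.H-1ₚ u v q) ⟩
    u ^ₚ q +ₚ v ^ₚ q ∎

  ∏[u-a*v]≋u^q-u*v^[q-1] : ∀ u v → ∏ₚ.∏< q (λ j → u -ₚ const (digit j) *ₚ v) ≋ u ^ₚ q -ₚ u *ₚ v ^ₚ (q ∸ 1)
  ∏[u-a*v]≋u^q-u*v^[q-1] u v = begin
    ∏ₚ.∏< q (λ j → u -ₚ const (digit j) *ₚ v)
      ≈⟨ H.H-∏X- u v q digit ⟨
    H.H u v q (∏ₚ.∏< q (λ j → X- digit j))
      ≈⟨ H.H-cong u v q ∏X-digit≋X^q-X ⟩
    H.H u v q (X^ q -ₚ X^ 1)
      ≈⟨ H.H-+ₚ u v q (X^ q) (-ₚ X^ 1) ⟩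
    H.H u v q (X^ q) +ₚ H.H u v q (-ₚ X^ 1)
      ≈⟨ +ₚ-cong (H-X^q u v) (≋-trans (H.H--ₚ u v q (X^ 1)) (-ₚ-cong (≋-trans (H.H-X^ u v q 1 (s≤s z≤n)) (*ₚ-congˡ _ (𝔽[X].*-identityʳ u))))) ⟩
    u ^ₚ q -ₚ u *ₚ v ^ₚ (q ∸ 1) ∎

  const-^ : ∀ a n → const (a ^ n) ≋ const a ^ₚ n
  const-^ a zero    = ≋-refl
  const-^ a (suc n) = ≋-trans (const-*ₚ a (a ^ n)) (*ₚ-congʳ (const a) (const-^ a n))

  frobenius-const-*ₚ : ∀ a u → (const a *ₚ u) ^ₚ q ≋ const a *ₚ u ^ₚ q
  frobenius-const-*ₚ a u =
    ≋-trans (^-distrib-* (const a) u q) (*ₚ-congˡ (u ^ₚ q) (≋-trans (≋-sym (const-^ a q)) (const-cong (fermat a))))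

  frobenius--ₚ : ∀ u v → (u -ₚ v) ^ₚ q ≋ u ^ₚ q -ₚ v ^ₚ q
  frobenius--ₚ u v = ≋-trans (frobenius u (-ₚ v)) (+ₚ-cong ≋-refl (begin
    (-ₚ v) ^ₚ q                ≈⟨ ^-congˡ q (≋-sym (const[-1]*ₚ v)) ⟩
    (const (- 1#) *ₚ v) ^ₚ q   ≈⟨ frobenius-const-*ₚ (- 1#) v ⟩
    const (- 1#) *ₚ v ^ₚ q     ≈⟨ const[-1]*ₚ (v ^ₚ q) ⟩
    -ₚ (v ^ₚ q)                ∎))

module Digits {c ℓ : Level} (F : FiniteField c ℓ) where

  open import Data.Nat using (_+_; _*_; _^_)
  open Algebra.Properties.CommutativeSemigroup ℕ.*-commutativeSemigroup using (x∙yz≈y∙xz)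

  open FiniteField F hiding (zero; _+_; _*_)
  open FiniteField F using () renaming (_+_ to _+ᶠ_; _*_ to _*ᶠ_)
  open Poly F
  open PolynomialRing F
  open FieldProperties F using (digit; toℕ-mod; digit-index)
  open PolynomialBasics F using (const; X^; _·X^_; coeff-X^-≢; coeff-X^-+)

  dig : ℕ → ℕ → Fin q
  dig zero    n = n mod q
  dig (suc i) n = dig i (n / q)

  dig-0 : ∀ i → dig i 0 ≡ fzero
  dig-0 zero    = ≡.refl
  dig-0 (suc i) = dig-0 i

  [s+q*b]%q≡s%q : ∀ s b → (s + q * b) % q ≡ s % q
  [s+q*b]%q≡s%q s b = ≡.trans (≡.cong (λ t → (s + t) % q) (ℕ.*-comm q b)) ([m+kn]%n≡m%n s b q)

  [s+q*b]/q≡s/q+b : ∀ s b → (s + q * b) / q ≡ s / q + b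
  [s+q*b]/q≡s/q+b s b = ≡.trans (+-distrib-/-∣ʳ s (divides b (ℕ.*-comm q b)))
                          (≡.cong (s / q +_) (≡.trans (≡.cong (_/ q) (ℕ.*-comm q b)) (m*n/n≡m b q)))

  k*q^[1+m]+s≡s+q*[k*q^m] : ∀ k m s → k * q ^ suc m + s ≡ s + q * (k * q ^ m)
  k*q^[1+m]+s≡s+q*[k*q^m] k m s = ≡.trans (ℕ.+-comm _ s) (≡.cong (s +_) (x∙yz≈y∙xz k q (q ^ m)))

  mod-cong : ∀ {a b} → a % q ≡ b % q → a mod q ≡ b mod q
  mod-cong {a} {b} e = Fin.toℕ-injective (≡.trans (toℕ-mod a) (≡.trans e (≡.sym (toℕ-mod b))))

  dig-low : ∀ i m k s → i < m → dig i (k * q ^ m + s) ≡ dig i s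
  dig-low zero    (suc m) k s _ = mod-cong {k * q ^ suc m + s} {s}
    (≡.trans (≡.cong (_% q) (k*q^[1+m]+s≡s+q*[k*q^m] k m s)) ([s+q*b]%q≡s%q s (k * q ^ m)))
  dig-low (suc i) (suc m) k s (s≤s i<m) = ≡.trans
    (≡.cong (λ t → dig i (t / q)) (k*q^[1+m]+s≡s+q*[k*q^m] k m s))
    (≡.trans (≡.cong (dig i) (≡.trans ([s+q*b]/q≡s/q+b s (k * q ^ m)) (ℕ.+-comm (s / q) _))) (dig-low i m k (s / q) i<m))

  dig-high : ∀ m i k s → s < q ^ m → dig (m + i) (k * q ^ m + s) ≡ dig i k
  dig-high zero    i k zero    _        = ≡.cong (dig i) (≡.trans (ℕ.+-identityʳ _) (ℕ.*-identityʳ k))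
  dig-high zero    i k (suc s) (s≤s ())
  dig-high (suc m) i k s s<q^[1+m] = ≡.trans
    (≡.cong (λ t → dig (m + i) (t / q)) (k*q^[1+m]+s≡s+q*[k*q^m] k m s))
    (≡.trans (≡.cong (dig (m + i)) (≡.trans ([s+q*b]/q≡s/q+b s (k * q ^ m)) (ℕ.+-comm (s / q) _)))
             (dig-high m i k (s / q) (m<n*o⇒m/o<n (≡.subst (s <_) (ℕ.*-comm q (q ^ m)) s<q^[1+m]))))

  dig-<q : ∀ i k → k < q → dig (suc i) k ≡ fzero
  dig-<q i k k<q = ≡.trans (≡.cong (dig i) (m<n⇒m/n≡0 k<q)) (dig-0 i)

  n<q^n : ∀ n → n < q ^ n
  n<q^n zero    = s≤s z≤n
  n<q^n (suc n) = begin-strict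
    suc n          <⟨ s≤s (n<q^n n) ⟩
    suc (q ^ n)    ≤⟨ ℕ.+-monoˡ-≤ (q ^ n) (ℕ.m^n>0 q n) ⟩
    q ^ n + q ^ n  ≡⟨ ≡.cong (q ^ n +_) (ℕ.+-identityʳ (q ^ n)) ⟨
    2 * q ^ n      ≤⟨ ℕ.*-monoˡ-≤ (q ^ n) {2} {q} (s≤s (s≤s z≤n)) ⟩
    q * q ^ n      ∎
    where open ℕ.≤-Reasoning

  coeff-decodeAux : ∀ fuel n i → n < q ^ fuel → coeff (decodeAux fuel n) i ≈ enum (dig i n)
  coeff-decodeAux zero     zero    i _         = trans (sym enum-0) (reflexive (≡.cong enum (≡.sym (dig-0 i))))
  coeff-decodeAux zero     (suc n) i (s≤s ())
  coeff-decodeAux (suc fu) n       zero    _   = refl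
  coeff-decodeAux (suc fu) n       (suc i) n<q^[1+fu] =
    coeff-decodeAux fu (n / q) i (m<n*o⇒m/o<n (≡.subst (n <_) (ℕ.*-comm q (q ^ fu)) n<q^[1+fu]))

  coeff-decode : ∀ n i → coeff (decode n) i ≈ enum (dig i n)
  coeff-decode n i = coeff-decodeAux n n i (n<q^n n)

  decode-split : ∀ m k s → k < q → s < q ^ m → decode (k * q ^ m + s) ≋ decode s +ₚ digit k ·X^ m
  decode-split m k s k<q s<q^m = mk λ i → trans (coeff-decode _ i) (sym (trans (rhs i) (digits i)))
    where
    rhs : ∀ i → coeff (decode s +ₚ digit k ·X^ m) i ≈ enum (dig i s) +ᶠ digit k *ᶠ coeff (X^ m) i
    rhs i = trans (coeff-+ₚ (decode s) _ i)
      (+-cong (coeff-decode s i) (trans (coeff-≈ (*ₚ-const (digit k) (X^ m)) i) (coeff-·ₚ (digit k) (X^ m) i)))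
    digits : ∀ i → enum (dig i s) +ᶠ digit k *ᶠ coeff (X^ m) i ≈ enum (dig i (k * q ^ m + s))
    digits i with i ℕ.<? m
    ... | yes i<m = trans (+-congˡ (trans (*-congˡ (coeff-X^-≢ (ℕ.>⇒≢ i<m))) (zeroʳ _)))
                          (trans (+-identityʳ _) (reflexive (≡.cong enum (≡.sym (dig-low i m k s i<m)))))
    ... | no  i≮m with ℕ.m≤n⇒∃[o]m+o≡n (ℕ.≮⇒≥ i≮m)
    ...   | j , ≡.refl = trans (+-cong (trans (reflexive (≡.cong enum (≡.trans (dig-high m j 0 s s<q^m) (dig-0 j)))) enum-0)
                                           (*-congˡ (coeff-X^-+ m j)))
                               (trans (+-identityˡ _) (trans (top j) (reflexive (≡.cong enum (≡.sym (dig-high m j k s s<q^m))))))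
      where
      top : ∀ j → digit k *ᶠ coeff 1ₚ j ≈ enum (dig j k)
      top zero    = *-identityʳ _
      top (suc j) = trans (zeroʳ _) (trans (sym enum-0) (reflexive (≡.cong enum (≡.sym (dig-<q j k k<q)))))

  coeff-δ : ∀ p i → coeff p i ≈ enum (dig i (δ p))
  coeff-δ []      i       = trans (sym enum-0) (reflexive (≡.cong enum (≡.sym (dig-0 i))))
  coeff-δ (a ∷ p) zero    = trans (sym (digit-index a))
    (reflexive (≡.cong enum (mod-cong {toℕ (index a)} {toℕ (index a) + q * δ p} (≡.sym ([s+q*b]%q≡s%q (toℕ (index a)) (δ p))))))
  coeff-δ (a ∷ p) (suc i) = trans (coeff-δ p i) (reflexive (≡.cong (λ n → enum (dig i n)) (≡.sym (begin
    (toℕ (index a) + q * δ p) / q   ≡⟨ [s+q*b]/q≡s/q+b (toℕ (index a)) (δ p) ⟩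
    toℕ (index a) / q + δ p         ≡⟨ ≡.cong (_+ δ p) (m<n⇒m/n≡0 (Fin.toℕ<n (index a))) ⟩
    δ p                             ∎))))
    where open ≡.≡-Reasoning

  ≋-decode-δ : ∀ p → p ≋ decode (δ p)
  ≋-decode-δ p = mk λ i → trans (coeff-δ p i) (sym (coeff-decode (δ p) i))

  δ-≋[] : ∀ {p} → p ≋ [] → δ p ≡ 0
  δ-≋[] {[]}    _    = ≡.refl
  δ-≋[] {a ∷ p} p≋[] = ≡.trans (≡.cong₂ (λ i n → toℕ i + q * n) index-a≡0 (δ-≋[] (∷-≋[]-tail p≋[]))) (ℕ.*-zeroʳ q)
    where
    index-a≡0 : index a ≡ fzero
    index-a≡0 = ≡.trans (index-cong (trans (∷-≋[]-head p≋[]) (sym enum-0))) (index-enum fzero)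

  δ-cong : ∀ {p r} → p ≋ r → δ p ≡ δ r
  δ-cong {[]}    {[]}    _   = ≡.refl
  δ-cong {[]}    {b ∷ r} p≋r = ≡.sym (δ-≋[] (≋-sym p≋r))
  δ-cong {a ∷ p} {[]}    p≋r = δ-≋[] p≋r
  δ-cong {a ∷ p} {b ∷ r} p≋r = ≡.cong₂ (λ i n → toℕ i + q * n) (index-cong (∷-head p≋r)) (δ-cong (∷-tail p≋r))

module SubspaceProducts {c ℓ : Level} (F : FiniteField c ℓ) where

  open import Data.Nat using (_+_; _*_; _^_)

  open FiniteField F hiding (zero; _+_; _*_)
  open Poly F
  open PolynomialRing F
  open FieldProperties F using (digit)
  open PolynomialBasics F
  open Digits F using (decode-split)
  open ≋-Reasoning

  prodBelow-cong : ∀ {x y} n → x ≋ y → prodBelow x n ≋ prodBelow y n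
  prodBelow-cong zero    x≋y = ≋-refl
  prodBelow-cong (suc n) x≋y = *ₚ-cong (prodBelow-cong n x≋y) (+ₚ-cong x≋y ≋-refl)

  prodBelow-≋[] : ∀ n x i → i < n → x ≋ decode i → prodBelow x n ≋ []
  prodBelow-≋[] (suc n) x i i<1+n x≋hᵢ with ℕ.m≤n⇒m<n∨m≡n (ℕ.≤-pred i<1+n)
  ... | inj₁ i<n     = *ₚ-zeroˡ _ (prodBelow-≋[] n x i i<n x≋hᵢ)
  ... | inj₂ ≡.refl = ≋-trans (*ₚ-congʳ (prodBelow x n) (≋-trans (+ₚ-cong x≋hᵢ ≋-refl) (-ₚ-inverseʳ (decode i))))
                              (*ₚ-zeroʳ (prodBelow x n))

  -- P m x = ∏ (x - h), h ranging over the q ^ m polynomials of degree < m.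
  P : ℕ → Pol → Pol
  P m x = prodBelow x (q ^ m)

  -- The polynomials decode (k q^m + s), s < q^m, are those of decode s shifted by digit k · X^m.
  prodBelow-split : ∀ m k s x → k < q → s ≤ q ^ m →
                    prodBelow x (k * q ^ m + s) ≋ prodBelow x (k * q ^ m) *ₚ prodBelow (x -ₚ digit k ·X^ m) s
  prodBelow-split m k zero    x k<q s≤q^m =
    ≋-trans (≋-reflexive (≡.cong (prodBelow x) (ℕ.+-identityʳ (k * q ^ m)))) (≋-sym (𝔽[X].*-identityʳ (prodBelow x (k * q ^ m))))
  prodBelow-split m k (suc s) x k<q s<q^m = begin
    prodBelow x (k * q ^ m + suc s)
      ≡⟨ ≡.cong (prodBelow x) (ℕ.+-suc (k * q ^ m) s) ⟩
    prodBelow x (k * q ^ m + s) *ₚ (x -ₚ decode (k * q ^ m + s))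
      ≈⟨ *ₚ-cong (prodBelow-split m k s x k<q (ℕ.<⇒≤ s<q^m)) (+ₚ-cong ≋-refl (-ₚ-cong (decode-split m k s k<q s<q^m))) ⟩
    (A *ₚ B) *ₚ (x -ₚ (decode s +ₚ digit k ·X^ m))
      ≈⟨ solve 5 (λ A B x h t → (A :* B) :* (x :- (h :+ t)) := A :* (B :* ((x :- t) :- h))) ≋-refl A B x (decode s) (digit k ·X^ m) ⟩
    A *ₚ (B *ₚ ((x -ₚ digit k ·X^ m) -ₚ decode s)) ∎
    where
    open 𝔽[X]-Solver
    A = prodBelow x (k * q ^ m)
    B = prodBelow (x -ₚ digit k ·X^ m) s

  prodBelow-blocks : ∀ m k x → k ≤ q → prodBelow x (k * q ^ m) ≋ ∏ₚ.∏< k (λ j → P m (x -ₚ digit j ·X^ m))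
  prodBelow-blocks m zero    x _      = ≋-refl
  prodBelow-blocks m (suc k) x 1+k≤q = begin
    prodBelow x (q ^ m + k * q ^ m)                                      ≡⟨ ≡.cong (prodBelow x) (ℕ.+-comm (q ^ m) (k * q ^ m)) ⟩
    prodBelow x (k * q ^ m + q ^ m)                                      ≈⟨ prodBelow-split m k (q ^ m) x 1+k≤q ℕ.≤-refl ⟩
    prodBelow x (k * q ^ m) *ₚ P m (x -ₚ digit k ·X^ m)                  ≈⟨ *ₚ-congˡ _ (prodBelow-blocks m k x (ℕ.<⇒≤ 1+k≤q)) ⟩
    ∏ₚ.∏< k (λ j → P m (x -ₚ digit j ·X^ m)) *ₚ P m (x -ₚ digit k ·X^ m) ∎

  P-suc : ∀ m x → P (suc m) x ≋ ∏ₚ.∏< q (λ j → P m (x -ₚ digit j ·X^ m))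
  P-suc m x = prodBelow-blocks m q x ℕ.≤-refl

module Linearity {c ℓ : Level} (F : FiniteField c ℓ) where

  open import Data.Nat using (_+_; _*_; _^_)

  open FiniteField F hiding (zero; _+_; _*_)
  open Poly F
  open PolynomialRing F
  open FieldProperties F using (digit)
  open PolynomialBasics F
  open Frobenius F
  open SubspaceProducts F
  open Algebra.Properties.Semiring.Exp 𝔽[X].semiring using (^-congˡ) renaming (_^_ to _^ₚ_)
  open ≋-Reasoning

  -- Carlitz's D m, the product of all monic polynomials of degree m.
  D : ℕ → Pol
  D m = P m (X^ m)

  IsLinear : (Pol → Pol) → Set (c ⊔ ℓ)
  IsLinear f = (∀ x y → f (x +ₚ y) ≋ f x +ₚ f y) × (∀ a x → f (const a *ₚ x) ≋ const a *ₚ f x)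

  P-0 : ∀ x → P 0 x ≋ x
  P-0 x = ≋-trans (*ₚ-identityˡ _) (+ₚ-identityʳ x)

  P--ₚ : ∀ m → IsLinear (P m) → ∀ x y → P m (x -ₚ y) ≋ P m x -ₚ P m y
  P--ₚ m (additive , homogeneous) x y = begin
    P m (x -ₚ y)                     ≈⟨ additive x (-ₚ y) ⟩
    P m x +ₚ P m (-ₚ y)              ≈⟨ +ₚ-cong ≋-refl (prodBelow-cong (q ^ m) (≋-sym (const[-1]*ₚ y))) ⟩
    P m x +ₚ P m (const (- 1#) *ₚ y) ≈⟨ +ₚ-cong ≋-refl (≋-trans (homogeneous (- 1#) y) (const[-1]*ₚ (P m y))) ⟩
    P m x -ₚ P m y                   ∎

  P-recursion : ∀ m → IsLinear (P m) → ∀ x → P (suc m) x ≋ P m x ^ₚ q -ₚ P m x *ₚ D m ^ₚ (q ∸ 1)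
  P-recursion m linear x = begin
    P (suc m) x
      ≈⟨ P-suc m x ⟩
    ∏ₚ.∏< q (λ j → P m (x -ₚ digit j ·X^ m))
      ≈⟨ ∏ₚ.∏<-cong q (λ j → ≋-trans (P--ₚ m linear x (digit j ·X^ m)) (+ₚ-cong ≋-refl (-ₚ-cong (proj₂ linear (digit j) (X^ m))))) ⟩
    ∏ₚ.∏< q (λ j → P m x -ₚ const (digit j) *ₚ D m)
      ≈⟨ ∏[u-a*v]≋u^q-u*v^[q-1] (P m x) (D m) ⟩
    P m x ^ₚ q -ₚ P m x *ₚ D m ^ₚ (q ∸ 1) ∎

  -- P (m + 1) x is a polynomial in P m x whose monomials are additive and 𝔽_q-homogeneous.
  P-linear : ∀ m → IsLinear (P m)
  P-linear zero    = (λ x y → ≋-trans (P-0 (x +ₚ y)) (≋-sym (+ₚ-cong (P-0 x) (P-0 y))))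
                   , (λ a x → ≋-trans (P-0 (const a *ₚ x)) (*ₚ-congʳ (const a) (≋-sym (P-0 x))))
  P-linear (suc m) = additive , homogeneous
    where
    open 𝔽[X]-Solver
    E = D m ^ₚ (q ∸ 1)
    recursion = P-recursion m (P-linear m)
    additive : ∀ x y → P (suc m) (x +ₚ y) ≋ P (suc m) x +ₚ P (suc m) y
    additive x y = begin
      P (suc m) (x +ₚ y)
        ≈⟨ recursion (x +ₚ y) ⟩
      P m (x +ₚ y) ^ₚ q -ₚ P m (x +ₚ y) *ₚ E
        ≈⟨ +ₚ-cong (≋-trans (^-congˡ q (proj₁ (P-linear m) x y)) (frobenius (P m x) (P m y))) (-ₚ-cong (*ₚ-congˡ E (proj₁ (P-linear m) x y))) ⟩
      (P m x ^ₚ q +ₚ P m y ^ₚ q) -ₚ (P m x +ₚ P m y) *ₚ E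
        ≈⟨ solve 5 (λ a b aq bq e → (aq :+ bq) :- (a :+ b) :* e := (aq :- a :* e) :+ (bq :- b :* e)) ≋-refl (P m x) (P m y) (P m x ^ₚ q) (P m y ^ₚ q) E ⟩
      (P m x ^ₚ q -ₚ P m x *ₚ E) +ₚ (P m y ^ₚ q -ₚ P m y *ₚ E)
        ≈⟨ +ₚ-cong (recursion x) (recursion y) ⟨
      P (suc m) x +ₚ P (suc m) y ∎
    homogeneous : ∀ a x → P (suc m) (const a *ₚ x) ≋ const a *ₚ P (suc m) x
    homogeneous a x = begin
      P (suc m) (const a *ₚ x)
        ≈⟨ recursion (const a *ₚ x) ⟩
      P m (const a *ₚ x) ^ₚ q -ₚ P m (const a *ₚ x) *ₚ E
        ≈⟨ +ₚ-cong (≋-trans (^-congˡ q (proj₂ (P-linear m) a x)) (frobenius-const-*ₚ a (P m x))) (-ₚ-cong (*ₚ-congˡ E (proj₂ (P-linear m) a x))) ⟩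
      const a *ₚ P m x ^ₚ q -ₚ (const a *ₚ P m x) *ₚ E
        ≈⟨ solve 4 (λ c a aq e → c :* aq :- (c :* a) :* e := c :* (aq :- a :* e)) ≋-refl (const a) (P m x) (P m x ^ₚ q) E ⟩
      const a *ₚ (P m x ^ₚ q -ₚ P m x *ₚ E)
        ≈⟨ *ₚ-congʳ (const a) (recursion x) ⟨
      const a *ₚ P (suc m) x ∎

module Carlitz {c ℓ : Level} (F : FiniteField c ℓ) where

  open import Data.Nat using (_+_; _*_; _^_)

  open FiniteField F hiding (zero; _+_; _*_)
  open Poly F
  open PolynomialRing F
  open PolynomialBasics F
  open Frobenius F
  open SubspaceProducts F
  open Linearity F
  open Algebra.Properties.Semiring.Exp 𝔽[X].semiring using (^-congˡ; ^-assocʳ) renaming (_^_ to _^ₚ_)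
  open Algebra.Properties.CommutativeSemiring.Exp 𝔽[X].commutativeSemiring using (^-distrib-*)
  open 𝔽[X]-Solver
  open ≋-Reasoning

  -- Carlitz's [j + 1] = X ^ (q ^ (j + 1)) - X, by the Frobenius identity.
  L : ℕ → Pol
  L zero    = X ^ₚ q -ₚ X
  L (suc j) = L j ^ₚ q +ₚ L zero

  ^-swap : ∀ y m n → (y ^ₚ m) ^ₚ n ≋ (y ^ₚ n) ^ₚ m
  ^-swap y m n = ≋-trans (^-assocʳ y m n) (≋-trans (≋-reflexive (≡.cong (y ^ₚ_) (ℕ.*-comm m n))) (≋-sym (^-assocʳ y n m)))

  recursion : ∀ m x → P (suc m) x ≋ P m x ^ₚ q -ₚ P m x *ₚ D m ^ₚ (q ∸ 1)
  recursion m = P-recursion m (P-linear m)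

  -- How P (j + 1) commutes with multiplication by X; at x = X ^ j it gives D (j + 1).
  Twist : ℕ → Set (c ⊔ ℓ)
  Twist j = ∀ x → P (suc j) (X *ₚ x) ≋ X *ₚ P (suc j) x +ₚ L j *ₚ P j x ^ₚ q

  -- D ^ q = D * D ^ (q - 1) holds by definition, so the recursion gives P (j + 1) (X ^ j) = 0.
  P[1+j]X^j≋[] : ∀ j → P (suc j) (X^ j) ≋ []
  P[1+j]X^j≋[] j = ≋-trans (recursion j (X^ j)) (-ₚ-inverseʳ (D j ^ₚ q))

  twist⇒D-suc : ∀ j → Twist j → D (suc j) ≋ D j ^ₚ q *ₚ L j
  twist⇒D-suc j twist = begin
    P (suc j) (X^ (suc j))                                 ≈⟨ prodBelow-cong (q ^ suc j) (≋-sym (X*ₚ (X^ j))) ⟩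
    P (suc j) (X *ₚ X^ j)                                  ≈⟨ twist (X^ j) ⟩
    X *ₚ P (suc j) (X^ j) +ₚ L j *ₚ D j ^ₚ q               ≈⟨ +ₚ-cong (*ₚ-congʳ X (P[1+j]X^j≋[] j)) ≋-refl ⟩
    X *ₚ [] +ₚ L j *ₚ D j ^ₚ q                             ≈⟨ +ₚ-cong (*ₚ-zeroʳ X) (*ₚ-comm (L j) _) ⟩
    D j ^ₚ q *ₚ L j                                        ∎

  1ₚ^n≋1ₚ : ∀ n → 1ₚ ^ₚ n ≋ 1ₚ
  1ₚ^n≋1ₚ zero    = ≋-refl
  1ₚ^n≋1ₚ (suc n) = ≋-trans (*ₚ-identityˡ _) (1ₚ^n≋1ₚ n)

  P-1 : ∀ y → P 1 y ≋ y ^ₚ q -ₚ y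
  P-1 y = ≋-trans (recursion 0 y) (+ₚ-cong (^-congˡ q (P-0 y)) (-ₚ-cong (begin
    P 0 y *ₚ D 0 ^ₚ (q ∸ 1)   ≈⟨ *ₚ-cong (P-0 y) (^-congˡ (q ∸ 1) (P-0 1ₚ)) ⟩
    y *ₚ 1ₚ ^ₚ (q ∸ 1)        ≈⟨ *ₚ-congʳ y (1ₚ^n≋1ₚ (q ∸ 1)) ⟩
    y *ₚ 1ₚ                   ≈⟨ 𝔽[X].*-identityʳ y ⟩
    y                         ∎)))

  twist-0 : Twist 0
  twist-0 x = begin
    P 1 (X *ₚ x)
      ≈⟨ P-1 (X *ₚ x) ⟩
    (X *ₚ x) ^ₚ q -ₚ X *ₚ x
      ≈⟨ +ₚ-cong (^-distrib-* X x q) ≋-refl ⟩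
    X ^ₚ q *ₚ x ^ₚ q -ₚ X *ₚ x
      ≈⟨ solve 4 (λ X x Xq xq → Xq :* xq :- X :* x := X :* (xq :- x) :+ (Xq :- X) :* xq) ≋-refl X x (X ^ₚ q) (x ^ₚ q) ⟩
    X *ₚ (x ^ₚ q -ₚ x) +ₚ L 0 *ₚ x ^ₚ q
      ≈⟨ +ₚ-cong (*ₚ-congʳ X (P-1 x)) (*ₚ-congʳ (L 0) (^-congˡ q (P-0 x))) ⟨
    X *ₚ P 1 x +ₚ L 0 *ₚ P 0 x ^ₚ q ∎

  twist-suc : ∀ j → Twist j → Twist (suc j)
  twist-suc j twist x = begin
    P (2 + j) (X *ₚ x)
      ≈⟨ recursion (suc j) (X *ₚ x) ⟩
    P (suc j) (X *ₚ x) ^ₚ q -ₚ P (suc j) (X *ₚ x) *ₚ D (suc j) ^ₚ (q ∸ 1)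
      ≈⟨ +ₚ-cong (^-congˡ q (twist x)) (-ₚ-cong (*ₚ-cong (twist x) D′^[q-1])) ⟩
    (X *ₚ A +ₚ l *ₚ Bq) ^ₚ q -ₚ (X *ₚ A +ₚ l *ₚ Bq) *ₚ (e *ₚ l^[q-1])
      ≈⟨ +ₚ-cong (≋-trans (frobenius (X *ₚ A) (l *ₚ Bq)) (+ₚ-cong (≋-trans (^-distrib-* X A q) (*ₚ-congʳ (X ^ₚ q) A^q)) (^-distrib-* l Bq q))) ≋-refl ⟩
    (X ^ₚ q *ₚ (Bq ^ₚ q -ₚ Bq *ₚ e) +ₚ (l *ₚ l^[q-1]) *ₚ Bq ^ₚ q) -ₚ (X *ₚ A +ₚ l *ₚ Bq) *ₚ (e *ₚ l^[q-1])
      -- l ^ q is l * l ^ (q - 1) by definition, which the solver needs to see.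
      ≈⟨ solve 8 (λ X Xq a bq bqq l lqm e →
           (Xq :* (bqq :- bq :* e) :+ (l :* lqm) :* bqq) :- (X :* a :+ l :* bq) :* (e :* lqm)
           := X :* ((bqq :- bq :* e) :- a :* (e :* lqm)) :+ ((l :* lqm) :+ (Xq :- X)) :* (bqq :- bq :* e))
         ≋-refl X (X ^ₚ q) A Bq (Bq ^ₚ q) l l^[q-1] e ⟩
    X *ₚ ((Bq ^ₚ q -ₚ Bq *ₚ e) -ₚ A *ₚ (e *ₚ l^[q-1])) +ₚ L (suc j) *ₚ (Bq ^ₚ q -ₚ Bq *ₚ e)
      ≈⟨ +ₚ-cong (*ₚ-congʳ X (≋-trans (+ₚ-cong (≋-sym A^q) (-ₚ-cong (*ₚ-congʳ A (≋-sym D′^[q-1])))) (≋-sym (recursion (suc j) x)))) (*ₚ-congʳ (L (suc j)) (≋-sym A^q)) ⟩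
    X *ₚ P (2 + j) x +ₚ L (suc j) *ₚ P (suc j) x ^ₚ q
      ∎
    where
    A = P (suc j) x
    Bq = P j x ^ₚ q
    l = L j
    l^[q-1] = l ^ₚ (q ∸ 1)
    e = (D j ^ₚ (q ∸ 1)) ^ₚ q
    A^q : A ^ₚ q ≋ Bq ^ₚ q -ₚ Bq *ₚ e
    A^q = ≋-trans (^-congˡ q (recursion j x)) (≋-trans (frobenius--ₚ Bq _) (+ₚ-cong ≋-refl (-ₚ-cong (^-distrib-* (P j x) _ q))))
    D′^[q-1] : D (suc j) ^ₚ (q ∸ 1) ≋ e *ₚ l^[q-1]
    D′^[q-1] = begin
      D (suc j) ^ₚ (q ∸ 1)
        ≈⟨ ^-congˡ (q ∸ 1) (twist⇒D-suc j twist) ⟩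
      (D j ^ₚ q *ₚ l) ^ₚ (q ∸ 1)
        ≈⟨ ^-distrib-* (D j ^ₚ q) l (q ∸ 1) ⟩
      (D j ^ₚ q) ^ₚ (q ∸ 1) *ₚ l^[q-1]
        ≈⟨ *ₚ-congˡ l^[q-1] (^-swap (D j) q (q ∸ 1)) ⟩
      e *ₚ l^[q-1] ∎

  twist : ∀ j → Twist j
  twist zero    = twist-0
  twist (suc j) = twist-suc j (twist j)

  D-suc : ∀ j → D (suc j) ≋ D j ^ₚ q *ₚ L j
  D-suc j = twist⇒D-suc j (twist j)

module Factorials {c ℓ : Level} (F : FiniteField c ℓ) where

  open import Data.Nat using (_+_; _*_; _^_)

  open FiniteField F hiding (zero; _+_; _*_)
  open Poly F
  open PolynomialRing F
  open FieldProperties F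
  open PolynomialBasics F
  open Evaluation F using (module ∏ᶠ)
  open Digits F
  open SubspaceProducts F
  open Linearity F
  open Carlitz F using (D-suc; L)
  open Algebra.Properties.Semiring.Exp 𝔽[X].semiring using (^-homo-*; ^-congʳ) renaming (_^_ to _^ₚ_)
  open Algebra.Properties.CommutativeSemigroup.Divisibility 𝔽[X].*-commutativeSemigroup
  open Algebra.Properties.Monoid.Divisibility 𝔽[X].*-monoid using (∣ʳ-refl; ∣ʳ-reflexive; ε∣ʳ_)
  open 𝔽[X]-Solver

  decode! : ℕ → Pol
  decode! n = prodBelow (decode n) n

  fact≋decode!-δ : ∀ f → fact f ≋ decode! (δ f)
  fact≋decode!-δ f = prodBelow-cong (δ f) (≋-decode-δ f)

  digitGaps : ℕ → ℕ → Carrier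
  digitGaps d n = ∏ᶠ.∏< n (λ j → digit d - digit j)

  digitGaps-≉0 : ∀ d n → n ≤ d → d < q → digitGaps d n ≉0
  digitGaps-≉0 d zero    _     _   1≈0 = 0≉1 (sym 1≈0)
  digitGaps-≉0 d (suc n) n<d d<q = x≉0∧y≉0⇒x*y≉0 (digitGaps-≉0 d n (ℕ.<⇒≤ n<d) d<q)
    λ gap≈0 → ℕ.<⇒≢ n<d (≡.sym (digit-injective d<q (ℕ.<-trans n<d d<q) (x-y≈0⇒x≈y gap≈0)))

  ∏<-const*ₚ : ∀ (f : ℕ → Carrier) y n → ∏ₚ.∏< n (λ j → const (f j) *ₚ y) ≋ const (∏ᶠ.∏< n f) *ₚ y ^ₚ n
  ∏<-const*ₚ f y zero    = ≋-sym (*ₚ-identityˡ 1ₚ)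
  ∏<-const*ₚ f y (suc n) = begin
    ∏ₚ.∏< n (λ j → const (f j) *ₚ y) *ₚ (const (f n) *ₚ y)
      ≈⟨ *ₚ-congˡ _ (∏<-const*ₚ f y n) ⟩
    (const (∏ᶠ.∏< n f) *ₚ y ^ₚ n) *ₚ (const (f n) *ₚ y)
      ≈⟨ solve 4 (λ C Yn E Y → (C :* Yn) :* (E :* Y) := (C :* E) :* (Y :* Yn)) ≋-refl (const (∏ᶠ.∏< n f)) (y ^ₚ n) (const (f n)) y ⟩
    (const (∏ᶠ.∏< n f) *ₚ const (f n)) *ₚ y ^ₚ suc n
      ≈⟨ *ₚ-congˡ (y ^ₚ suc n) (≋-sym (const-*ₚ _ (f n))) ⟩
    const (∏ᶠ.∏< (suc n) f) *ₚ y ^ₚ suc n ∎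
    where open ≋-Reasoning

  -- The block of digit j < d contributes P m (decode n - digit j · X^m) = (digit d - digit j) D m.
  decode!-split : ∀ m d r → d < q → r < q ^ m → decode! (d * q ^ m + r) ≋ const (digitGaps d d) *ₚ (D m ^ₚ d *ₚ decode! r)
  decode!-split m d r d<q r<q^m = begin
    prodBelow x (d * q ^ m + r)
      ≈⟨ prodBelow-split m d r x d<q (ℕ.<⇒≤ r<q^m) ⟩
    prodBelow x (d * q ^ m) *ₚ prodBelow (x -ₚ digit d ·X^ m) r
      ≈⟨ *ₚ-cong (prodBelow-blocks m d x (ℕ.<⇒≤ d<q)) (prodBelow-cong r x-top≋) ⟩
    ∏ₚ.∏< d (λ j → P m (x -ₚ digit j ·X^ m)) *ₚ decode! r
      ≈⟨ *ₚ-congˡ (decode! r) (≋-trans (∏ₚ.∏<-cong d block) (∏<-const*ₚ (λ j → digit d - digit j) (D m) d)) ⟩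
    const (digitGaps d d) *ₚ D m ^ₚ d *ₚ decode! r
      ≈⟨ 𝔽[X].*-assoc (const (digitGaps d d)) (D m ^ₚ d) (decode! r) ⟩
    const (digitGaps d d) *ₚ (D m ^ₚ d *ₚ decode! r) ∎
    where
    open ≋-Reasoning
    x = decode (d * q ^ m + r)
    x≋ : x ≋ decode r +ₚ digit d ·X^ m
    x≋ = decode-split m d r d<q r<q^m
    x-top≋ : x -ₚ digit d ·X^ m ≋ decode r
    x-top≋ = ≋-trans (+ₚ-cong x≋ ≋-refl) (solve 2 (λ h t → (h :+ t) :- t := h) ≋-refl (decode r) (digit d ·X^ m))
    Px≋ : P m x ≋ const (digit d) *ₚ D m
    Px≋ = begin
      P m x
        ≈⟨ prodBelow-cong (q ^ m) x≋ ⟩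
      P m (decode r +ₚ digit d ·X^ m)
        ≈⟨ proj₁ (P-linear m) (decode r) (digit d ·X^ m) ⟩
      P m (decode r) +ₚ P m (digit d ·X^ m)
        ≈⟨ +ₚ-cong (prodBelow-≋[] (q ^ m) (decode r) r r<q^m ≋-refl) (proj₂ (P-linear m) (digit d) (X^ m)) ⟩
      const (digit d) *ₚ D m ∎
    block : ∀ j → P m (x -ₚ digit j ·X^ m) ≋ const (digit d - digit j) *ₚ D m
    block j = begin
      P m (x -ₚ digit j ·X^ m)
        ≈⟨ P--ₚ m (P-linear m) x (digit j ·X^ m) ⟩
      P m x -ₚ P m (digit j ·X^ m)
        ≈⟨ +ₚ-cong Px≋ (-ₚ-cong (proj₂ (P-linear m) (digit j) (X^ m))) ⟩
      const (digit d) *ₚ D m -ₚ const (digit j) *ₚ D m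
        ≈⟨ solve 3 (λ a b y → a :* y :- b :* y := (a :- b) :* y) ≋-refl (const (digit d)) (const (digit j)) (D m) ⟩
      (const (digit d) -ₚ const (digit j)) *ₚ D m
        ≡⟨⟩
      const (digit d - digit j) *ₚ D m ∎

  const-unit-∣ : ∀ {a} y → a ≉0 → const a *ₚ y ∣ y
  const-unit-∣ {a} y a≉0 = const a⁻¹ , (begin
    const a⁻¹ *ₚ (const a *ₚ y)   ≈⟨ solve 3 (λ b a y → b :* (a :* y) := (a :* b) :* y) ≋-refl (const a⁻¹) (const a) y ⟩
    (const a *ₚ const a⁻¹) *ₚ y   ≈⟨ *ₚ-congˡ y (≋-trans (≋-sym (const-*ₚ a a⁻¹)) (const-cong (proj₂ (inverse a a≉0)))) ⟩
    1ₚ *ₚ y                       ≈⟨ *ₚ-identityˡ y ⟩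
    y                             ∎)
    where
    open ≋-Reasoning
    a⁻¹ = proj₁ (inverse a a≉0)

  ^-∣ : ∀ y {m n} → m ≤ n → y ^ₚ m ∣ y ^ₚ n
  ^-∣ y {m} {n} m≤n = y ^ₚ (n ∸ m) , ≋-trans (≋-sym (^-homo-* y (n ∸ m) m)) (^-congʳ y (ℕ.m∸n+n≡m m≤n))

  decode!-split-∣ : ∀ m d r → d < q → r < q ^ m → decode! (d * q ^ m + r) ∣ D m ^ₚ d *ₚ decode! r
  decode!-split-∣ m d r d<q r<q^m =
    ∣-respˡ-≈ (≋-sym (decode!-split m d r d<q r<q^m)) (const-unit-∣ _ (digitGaps-≉0 d d ℕ.≤-refl d<q))

  decode!-split-∣′ : ∀ m d r → d < q → r < q ^ m → D m ^ₚ d *ₚ decode! r ∣ decode! (d * q ^ m + r)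
  decode!-split-∣′ m d r d<q r<q^m = ∣-respʳ-≈ (≋-sym (decode!-split m d r d<q r<q^m)) (x∣yx _ (const (digitGaps d d)))

  leading-digit : ∀ m n → n < q ^ suc m → ∃₂ λ d r → d < q × r < q ^ m × n ≡ d * q ^ m + r
  leading-digit m n n<q^[1+m] = n / q ^ m , n % q ^ m , m<n*o⇒m/o<n n<q^[1+m] , m%n<n n (q ^ m) ,
    ≡.trans (m≡m%n+[m/n]*n n (q ^ m)) (ℕ.+-comm (n % q ^ m) _)
    where instance _ = ℕ.m^n≢0 q m

  compare-digits : ∀ Q {d d′ r r′} → r′ < Q → d * Q + r ≤ d′ * Q + r′ → d < d′ ⊎ (d ≡ d′ × r ≤ r′)
  compare-digits Q {d} {d′} {r} {r′} r′<Q n≤n′ with ℕ.<-cmp d d′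
  ... | tri< d<d′ _ _     = inj₁ d<d′
  ... | tri≈ _ ≡.refl _ = inj₂ (≡.refl , ℕ.+-cancelˡ-≤ (d * Q) r r′ n≤n′)
  ... | tri> _ _ d′<d     = ⊥-elim (ℕ.<-irrefl ≡.refl (begin-strict
    d * Q + r       ≤⟨ n≤n′ ⟩
    d′ * Q + r′     <⟨ ℕ.+-monoʳ-< (d′ * Q) r′<Q ⟩
    d′ * Q + Q      ≡⟨ ℕ.+-comm (d′ * Q) Q ⟩
    suc d′ * Q      ≤⟨ ℕ.*-monoˡ-≤ Q d′<d ⟩
    d * Q           ≤⟨ ℕ.m≤m+n (d * Q) r ⟩
    d * Q + r       ∎))
    where open ℕ.≤-Reasoning

  decode!-∣-D^[1+d] : ∀ m d r → d < q → r < q ^ m → decode! r ∣ D m → decode! (d * q ^ m + r) ∣ D m ^ₚ suc d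
  decode!-∣-D^[1+d] m d r d<q r<q^m r!∣D =
    ∣ʳ-trans (decode!-split-∣ m d r d<q r<q^m) (∣-respʳ-≈ (𝔽[X].*-comm _ (D m)) (x∣y⇒zx∣zy (D m ^ₚ d) r!∣D))

  -- D m ^ q ∣ D (m + 1) is where the Carlitz recursion enters.
  decode!-∣-D : ∀ m n → n < q ^ m → decode! n ∣ D m
  decode!-∣-D zero    zero    _ = ε∣ʳ D 0
  decode!-∣-D zero    (suc n) (s≤s ())
  decode!-∣-D (suc m) n n<q^[1+m] with leading-digit m n n<q^[1+m]
  ... | d , r , d<q , r<q^m , ≡.refl =
    ∣ʳ-trans (decode!-∣-D^[1+d] m d r d<q r<q^m (decode!-∣-D m r r<q^m))
      (∣ʳ-trans (^-∣ (D m) d<q) (∣-respʳ-≈ (≋-sym (D-suc m)) (x∣xy _ (L m))))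

  decode!-mono : ∀ m {n n′} → n ≤ n′ → n′ < q ^ m → decode! n ∣ decode! n′
  decode!-mono zero    {zero} {zero} _ _ = ∣ʳ-refl
  decode!-mono zero    {n} {suc n′} _ (s≤s ())
  decode!-mono (suc m) {n} {n′} n≤n′ n′<q^[1+m]
    with leading-digit m n (ℕ.≤-<-trans n≤n′ n′<q^[1+m]) | leading-digit m n′ n′<q^[1+m]
  ... | d , r , d<q , r<q^m , ≡.refl | d′ , r′ , d′<q , r′<q^m , ≡.refl
    with compare-digits (q ^ m) {d} {d′} {r} {r′} r′<q^m n≤n′
  ...   | inj₁ d<d′ = ∣ʳ-trans (decode!-∣-D^[1+d] m d r d<q r<q^m (decode!-∣-D m r r<q^m))
                        (∣ʳ-trans (^-∣ (D m) d<d′) (∣ʳ-trans (x∣xy _ (decode! r′)) (decode!-split-∣′ m d′ r′ d′<q r′<q^m)))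
  ...   | inj₂ (≡.refl , r≤r′) = ∣ʳ-trans (decode!-split-∣ m d r d<q r<q^m)
                        (∣ʳ-trans (x∣y⇒zx∣zy (D m ^ₚ d) (decode!-mono m r≤r′ r′<q^m)) (decode!-split-∣′ m d r′ d<q r′<q^m))

  fact-∣ : ∀ f g → g ≤ₚ f → fact g ∣ fact f
  fact-∣ f g (inj₁ δg<δf) = ∣-respˡ-≈ (≋-sym (fact≋decode!-δ g)) (∣-respʳ-≈ (≋-sym (fact≋decode!-δ f))
                                       (decode!-mono (δ f) (ℕ.<⇒≤ δg<δf) (n<q^n (δ f))))
  fact-∣ f g (inj₂ g≈f)   = ∣ʳ-reflexive (≋-trans (prodBelow-cong (δ g) g≋f) (≋-reflexive (≡.cong (prodBelow f) (δ-cong g≋f))))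
    where
    g≋f : g ≋ f
    g≋f = mk g≈f

  fact-∣ₚ : ∀ f g → g ≤ₚ f → fact g ∣ₚ fact f
  fact-∣ₚ f g g≤f with fact-∣ f g g≤f
  ... | h , h*g!≋f! = h , coeff-≈ (≋-trans (*ₚ-comm (fact g) h) h*g!≋f!)

corollary2p3 : ∀ {c ℓ : Level} (F : FiniteField c ℓ) (f g : Poly.Pol F) →
                   Poly._≤ₚ_ F g f → Poly._∣ₚ_ F (Poly.fact F g) (Poly.fact F f)
corollary2p3 F = Factorials.fact-∣ₚ F
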